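{- Let $L$ be a finite field of characteristic $p$ and order $q$, let $s$ be a positive integer with $\gcd(s,q-1)=1$, and for $a\in L$ let $W(a)=\sum_{x\in L}\mu(x^s-ax)$, where $\mu(x)=\exp(2\pi i\,\mathrm{Tr}_{L/\mathbb{F}_p}(x)/p)$. Suppose that $\{W(a): a\in L^\times\}=\{0,A,B\}$ where $A,B$ are distinct nonzero integers. Write $A=p^a\alpha$, $B=p^b\beta$, $A-B=p^c\gamma$ with $a,b,c\ge 0$ integers and $\alpha,\beta,\gamma$ integers not divisible by $p$. Then $\alpha,\beta,\gamma$ are pairwise coprime, $\alpha\gamma$ divides $q-B$, and $\beta\gamma$ divides $q-A$.
   Context: $L^\times$ denotes the multiplicative group of $L$. -}

module Defs where

open import Level using (0ℓ)
open import Algebra.Bundles using (CommutativeRing; Semiring)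
import Algebra.Definitions.RawSemiring as RawSemiringDefs
open import Data.Nat as ℕ using (ℕ; zero; suc)
open import Data.Fin using (Fin; toℕ)
import Data.Fin as Fin
open import Data.Integer as ℤ using (ℤ; +_)
open import Data.List as List using (List; map; allFin; upTo; foldr)
open import Data.Product using (∃; _,_)
open import Relation.Nullary using (¬_; does; Dec)
open import Relation.Binary using (Decidable)
open import Relation.Binary.PropositionalEquality using (_≡_)
open import Data.Bool using (if_then_else_)
import Data.Nat.ListAction as ListAction

-- Equality is decidable
-- (automatic for a finite field classically; needed to count solutions).
record FiniteField : Set₁ where
  field
    cring : CommutativeRing 0ℓ 0ℓ
  open CommutativeRing cring public
  open RawSemiringDefs (Semiring.rawSemiring (CommutativeRing.semiring cring)) public using (_^_) renaming (_×_ to _×ᴸ_)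
  field
    1≉0       : ¬ (1# ≈ 0#)
    inverse   : ∀ x → ¬ (x ≈ 0#) → ∃ λ y → x * y ≈ 1#
    _≟_       : Decidable _≈_
    order     : ℕ
    enum      : Fin order → Carrier
    enum-surj : ∀ x → ∃ λ i → enum i ≈ x
    enum-inj  : ∀ i j → enum i ≈ enum j → i ≡ j

-- Elements of the cyclotomic ring ℤ[ζ_p] (ζ_p = exp(2πi/p), p prime), as an
-- additive group: ℤ[ζ_p] ≅ ℤ^p / ℤ·(1,…,1), where u : Fin p → ℤ stands for
-- Σ_t u(t) ζ_p^t (the only ℤ-relation among 1,ζ,…,ζ^(p-1) is Σ ζ^t = 0).
Cyc : ℕ → Set
Cyc p = Fin p → ℤ

_≈ᶜ_ : ∀ {p} → Cyc p → Cyc p → Set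
u ≈ᶜ v = ∃ λ k → ∀ t → u t ≡ v t ℤ.+ k

ι : ∀ {p} → ℤ → Cyc p
ι A Fin.zero    = A
ι A (Fin.suc _) = + 0

module _ (L : FiniteField) where
  open FiniteField L

  Σᴸ : List Carrier → Carrier
  Σᴸ = foldr _+_ 0#

  -- absolute trace Tr_{L/F_p}(x) = Σ_{i<n} x^(p^i), where |L| = p^n
  trace : (p n : ℕ) → Carrier → Carrier
  trace p n x = Σᴸ (map (λ i → x ^ (p ℕ.^ i)) (upTo n))

  countL : (P : Carrier → Set) → ((x : Carrier) → Dec (P x)) → ℕ
  countL P P? = ListAction.sum (map (λ i → if does (P? (enum i)) then 1 else 0) (allFin order))

  -- The Weil sum W(a) = Σ_{x∈L} μ(x^s - a x), μ(y) = ζ_p^{Tr(y)}, as an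
  -- element of ℤ[ζ_p]: the coefficient of ζ_p^t is #{x : Tr(x^s - a x) = t}
  -- (t ∈ F_p identified with t·1 ∈ L).
  weil : (p n s : ℕ) → Carrier → Cyc p
  weil p n s a t =
    + countL (λ x → trace p n (x ^ s - a * x) ≈ (toℕ t ×ᴸ 1#))
             (λ x → trace p n (x ^ s - a * x) ≟ (toℕ t ×ᴸ 1#))

  HasCharacteristic : ℕ → Set
  HasCharacteristic p = (p ×ᴸ 1#) ≈ 0#

  Nonzero : Carrier → Set
  Nonzero a = ¬ (a ≈ 0#)

-- We count the coefficients N_a(t) = #{x | Tr(x^s − a x) = t} of W(a) ∈ ℤ[ζ_p] instead of
-- evaluating complex numbers.  If W(a) is the rational integer V then N_a(t) = V·[t = 0] + c,
-- so p·N_a(0) = q + (p − 1)·V and p·Σ_t N_a(t)² = q² + (p − 1)·V².  Summed over a ∈ L, both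
-- left-hand sides can be counted directly, because x ↦ x^s permutes L and the trace takes each
-- value of 𝔽_p equally often (a vanishing W(a) rules out Tr ≡ 0); this gives Σ_a W(a) = q and
-- Σ_a W(a)² = q².  If n_A, n_B are the numbers of a with W(a) = A, B, then A n_A + B n_B = q and
-- A² n_A + B² n_B = q², hence A(A − B) n_A = q(q − B) and B(B − A) n_B = q(q − A).  Cancelling
-- the power of p gives the divisibilities, and a common divisor of two of α, β, γ divides both
-- A and B, hence q, so it is 1.

module Submission where

open import Defs
open import Algebra.Bundles using (AbelianGroup; CommutativeMonoid)
open import Data.Empty using (⊥-elim)
open import Data.Fin as Fin using (Fin; toℕ)
import Data.Fin.Properties as FinP
import Data.List as List
open List using (List; []; _∷_)
import Data.List.Properties as ListP
open import Data.Nat as ℕ using (ℕ; zero; suc)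
open import Data.Nat.GCD using (gcd)
open import Data.Nat.Primality using (Prime)
import Data.Nat.Properties as ℕP
open import Data.Product using (_×_; ∃; ∃₂; _,_; proj₁; proj₂)
open import Data.Sum using (_⊎_; inj₁; inj₂)
open import Function using (_∘_; case_of_; Inverse; Congruent; Injective)
open import Relation.Binary.Bundles using (Setoid)
open import Relation.Binary.PropositionalEquality as ≡ using (_≡_; _≢_)
open import Relation.Nullary using (¬_; yes; no; contradiction)


module _ {c ℓ} (M : CommutativeMonoid c ℓ) where

  open CommutativeMonoid M
  open import Algebra.Properties.CommutativeMonoid.Sum M using (sum; sum-remove; sum-cong-≋; sum-replicate-zero)

  sum-supported-at : ∀ {n} (f : Fin n → Carrier) i → (∀ j → j ≢ i → f j ≈ ε) → sum f ≈ f i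
  sum-supported-at {suc n} f i f≈ε = trans (sum-remove f) (trans (∙-congˡ rest≈ε) (identityʳ (f i)))
    where
    rest≈ε : sum (λ j → f (Fin.punchIn i j)) ≈ ε
    rest≈ε = trans (sum-cong-≋ (λ j → f≈ε (Fin.punchIn i j) (FinP.punchInᵢ≢i i j)))
                   (sum-replicate-zero n)


module _ {a ℓ} (S : Setoid a ℓ) where

  open Setoid S
  open import Function.Consequences.Setoid using (strictlyInverseˡ⇒inverseˡ; strictlyInverseʳ⇒inverseʳ)

  mkInverse : (f g : Carrier → Carrier) → Congruent _≈_ _≈_ f → Congruent _≈_ _≈_ g →
              (∀ y → f (g y) ≈ y) → (∀ x → g (f x) ≈ x) → Inverse S S
  mkInverse f g f-cong g-cong fg gf = record
    { to = f ; from = g ; to-cong = f-cong ; from-cong = g-cong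
    ; inverse = strictlyInverseˡ⇒inverseˡ S S f-cong fg
              , strictlyInverseʳ⇒inverseʳ S S g-cong gf
    }


module _ {a ℓ} (G : AbelianGroup a ℓ) where

  open AbelianGroup G renaming (_∙_ to _+_; _⁻¹ to -_; ε to 0#)
  open import Relation.Binary.Reasoning.Setoid setoid

  telescope : ∀ x y z → (x - y) + (z - x) ≈ z - y
  telescope x y z = begin
    (x - y) + (z - x)     ≈⟨ comm _ _ ⟩
    (z - x) + (x - y)     ≈⟨ assoc _ _ _ ⟩
    z + (- x + (x - y))   ≈⟨ ∙-congˡ (assoc _ _ _) ⟨
    z + ((- x + x) - y)   ≈⟨ ∙-congˡ (∙-congʳ (inverseˡ x)) ⟩
    z + (0# - y)          ≈⟨ ∙-congˡ (identityˡ _) ⟩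
    z - y                 ∎

  swap-differences : ∀ {x y z w} → x - y ≈ z - w → w - y ≈ z - x
  swap-differences {x} {y} {z} {w} x-y≈z-w = begin
    w - y                 ≈⟨ telescope x y w ⟨
    (x - y) + (w - x)     ≈⟨ ∙-congʳ x-y≈z-w ⟩
    (z - w) + (w - x)     ≈⟨ comm _ _ ⟩
    (w - x) + (z - w)     ≈⟨ telescope w x z ⟩
    z - x                 ∎


module IntegerSums where

  open import Data.Integer using (ℤ; +_; _*_; _-_; _+_; NonZero)
  import Data.Integer.Properties as ℤP
  open import Data.Integer.Tactic.RingSolver using (solve-∀)
  open ≡ using (refl; sym; trans; cong; cong₂; module ≡-Reasoning)
  open import Algebra.Properties.Semiring.Sum ℤP.+-*-semiring public
    using (sum; sum-cong-≋; ∑-comm; ∑-distrib-+; *-distribˡ-sum; *-distribʳ-sum)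

  sum-const : ∀ m c → sum {m} (λ _ → c) ≡ + m * c
  sum-const zero    c = sym (ℤP.*-zeroˡ c)
  sum-const (suc m) c = trans (cong (λ x → c + x) (sum-const m c)) (regroup c (+ m))
    where
    regroup : ∀ c m → c + m * c ≡ (+ 1 + m) * c
    regroup = solve-∀

  sum-constant-off : ∀ {m} (f : Fin m → ℤ) i b → (∀ j → j ≢ i → f j ≡ b) → sum f ≡ + m * b + (f i - b)
  sum-constant-off {m} f i b f≡b = begin
    sum f                                     ≡⟨ sum-cong-≋ (λ j → split (f j) b) ⟩
    sum (λ j → b + (f j - b))                 ≡⟨ ∑-distrib-+ {m} (λ _ → b) (λ j → f j - b) ⟩
    sum {m} (λ _ → b) + sum (λ j → f j - b)
      ≡⟨ cong₂ _+_ (sum-const m b) (sum-supported-at ℤP.+-0-commutativeMonoid (λ j → f j - b) i f-b≡0) ⟩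
    + m * b + (f i - b)                       ∎
    where
    open ≡-Reasoning
    split : ∀ x b → x ≡ b + (x - b)
    split = solve-∀
    f-b≡0 : ∀ j → j ≢ i → f j - b ≡ + 0
    f-b≡0 j j≢i = trans (cong (_- b) (f≡b j j≢i)) (ℤP.+-inverseʳ b)

  sum-*-sum : ∀ {m n} (f : Fin m → ℤ) (g : Fin n → ℤ) → sum f * sum g ≡ sum (λ i → sum (λ j → f i * g j))
  sum-*-sum f g = trans (*-distribʳ-sum (sum g) f) (sum-cong-≋ (λ i → *-distribˡ-sum (f i) g))

  sum-affine : ∀ {m} (f g : Fin m → ℤ) a b c → (∀ i → a * f i ≡ b + c * g i) → a * sum f ≡ + m * b + c * sum g
  sum-affine {m} f g a b c af≡b+cg = begin
    a * sum f                                 ≡⟨ *-distribˡ-sum a f ⟩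
    sum (λ i → a * f i)                       ≡⟨ sum-cong-≋ af≡b+cg ⟩
    sum (λ i → b + c * g i)                   ≡⟨ ∑-distrib-+ (λ _ → b) (λ i → c * g i) ⟩
    sum {m} (λ _ → b) + sum (λ i → c * g i)   ≡⟨ cong₂ _+_ (sum-const m b) (sym (*-distribˡ-sum c g)) ⟩
    + m * b + c * sum g                       ∎
    where open ≡-Reasoning

  private
    0≡A0+B0 : ∀ A B → + 0 ≡ A * + 0 + B * + 0
    0≡A0+B0 = solve-∀
    A≡A1+B0 : ∀ A B → A ≡ A * + 1 + B * + 0
    A≡A1+B0 = solve-∀
    B≡A0+B1 : ∀ A B → B ≡ A * + 0 + B * + 1
    B≡A0+B1 = solve-∀

  three-valued-sums : ∀ {A B} {m} (f : Fin m → ℤ) → (∀ i → f i ≡ + 0 ⊎ f i ≡ A ⊎ f i ≡ B) →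
    ∃₂ λ nA nB → sum f ≡ A * nA + B * nB × sum (λ i → f i * f i) ≡ A * A * nA + B * B * nB
  three-valued-sums {A} {B} {zero}  f _ = + 0 , + 0 , 0≡A0+B0 A B , 0≡A0+B0 (A * A) (B * B)
  three-valued-sums {A} {B} {suc m} f f∈
    with three-valued-sums (f ∘ Fin.suc) (f∈ ∘ Fin.suc) | count (f∈ Fin.zero)
    where
    count : ∀ {x} → x ≡ + 0 ⊎ x ≡ A ⊎ x ≡ B →
            ∃₂ λ δA δB → x ≡ A * δA + B * δB × x * x ≡ A * A * δA + B * B * δB
    count (inj₁ refl)        = + 0 , + 0 , 0≡A0+B0 A B , 0≡A0+B0 (A * A) (B * B)
    count (inj₂ (inj₁ refl)) = + 1 , + 0 , A≡A1+B0 A B , A≡A1+B0 (A * A) (B * B)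
    count (inj₂ (inj₂ refl)) = + 0 , + 1 , B≡A0+B1 A B , B≡A0+B1 (A * A) (B * B)
  ... | nA , nB , Σ≡ , Σ²≡ | δA , δB , f₀≡ , f₀²≡ =
    δA + nA , δB + nB ,
    trans (cong₂ _+_ f₀≡ Σ≡) (regroup A B δA δB nA nB) ,
    trans (cong₂ _+_ f₀²≡ Σ²≡) (regroup (A * A) (B * B) δA δB nA nB)
    where
    regroup : ∀ A B δA δB nA nB → (A * δA + B * δB) + (A * nA + B * nB) ≡ A * (δA + nA) + B * (δB + nB)
    regroup = solve-∀

  integer-class-moments : ∀ {P} (u : Cyc (suc P)) V → u ≈ᶜ ι V →
    + suc P * u Fin.zero ≡ sum u + + P * V ×
    + suc P * sum (λ t → u t * u t) ≡ sum u * sum u + + P * (V * V)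
  integer-class-moments {P} u V (c , u≡ι+c) =
    trans (cong (+ suc P *_) u₀≡) (trans (first V c (+ P)) (cong (_+ + P * V) (sym Σu≡))) ,
    trans (cong (+ suc P *_) Σu²≡) (trans (second V c (+ P)) (cong (λ x → x * x + + P * (V * V)) (sym Σu≡)))
    where
    u₀≡ : u Fin.zero ≡ V + c
    u₀≡ = u≡ι+c Fin.zero
    uₜ≡ : ∀ t → u (Fin.suc t) ≡ c
    uₜ≡ t = trans (u≡ι+c (Fin.suc t)) (ℤP.+-identityˡ c)
    Σu≡ : sum u ≡ (V + c) + + P * c
    Σu≡ = cong₂ _+_ u₀≡ (trans (sum-cong-≋ uₜ≡) (sum-const P c))
    Σu²≡ : sum (λ t → u t * u t) ≡ (V + c) * (V + c) + + P * (c * c)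
    Σu²≡ = cong₂ _+_ (cong₂ _*_ u₀≡ u₀≡)
                     (trans (sum-cong-≋ (λ t → cong₂ _*_ (uₜ≡ t) (uₜ≡ t))) (sum-const P (c * c)))
    first : ∀ V c P → (+ 1 + P) * (V + c) ≡ ((V + c) + P * c) + P * V
    first = solve-∀
    second : ∀ V c P → (+ 1 + P) * ((V + c) * (V + c) + P * (c * c))
                     ≡ ((V + c) + P * c) * ((V + c) + P * c) + P * (V * V)
    second = solve-∀

  moment-from-count : ∀ {P M S V Q} q c .{{_ : NonZero P}} → Q ≡ c * q → (+ 1 + P) * M ≡ q →
    (+ 1 + P) * S ≡ q * Q + P * V → S ≡ c * (q * M + (q - M)) → V ≡ Q
  moment-from-count {P} {M} {S} {V} q c refl pM≡q pS≡ S≡ = ℤP.*-cancelˡ-≡ P V (c * q) (begin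
    P * V                                                             ≡⟨ isolate (q * (c * q)) (P * V) ⟩
    ((q * (c * q)) + P * V) - q * (c * q)                             ≡⟨ cong (_- q * (c * q)) (sym pS≡) ⟩
    (+ 1 + P) * S - q * (c * q)                                       ≡⟨ cong (λ x → (+ 1 + P) * x - q * (c * q)) S≡ ⟩
    (+ 1 + P) * (c * (q * M + (q - M))) - q * (c * q)                 ≡⟨ expand P M q c ⟩
    c * (q * ((+ 1 + P) * M) + ((+ 1 + P) * q - (+ 1 + P) * M)) - q * (c * q)
                                                                      ≡⟨ cong (λ x → c * (q * x + ((+ 1 + P) * q - x)) - q * (c * q)) pM≡q ⟩
    c * (q * q + ((+ 1 + P) * q - q)) - q * (c * q)                   ≡⟨ collapse P q c ⟩
    P * (c * q)                                                       ∎)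
    where
    open ≡-Reasoning
    isolate : ∀ a b → b ≡ (a + b) - a
    isolate = solve-∀
    expand : ∀ P M q c → (+ 1 + P) * (c * (q * M + (q - M))) - q * (c * q)
                       ≡ c * (q * ((+ 1 + P) * M) + ((+ 1 + P) * q - (+ 1 + P) * M)) - q * (c * q)
    expand = solve-∀
    collapse : ∀ P q c → c * (q * q + ((+ 1 + P) * q - q)) - q * (c * q) ≡ P * (c * q)
    collapse = solve-∀


module PrimeDivisibility where

  open import Data.Nat.Primality using (euclidsLemma; prime⇒irreducible; prime⇒nonZero; ¬prime[1])
  import Data.Nat.Divisibility as ℕ∣
  import Data.Nat.Coprimality as ℕC
  open import Data.Nat.GCD using (module Bézout)
  open import Data.Nat using (_!)
  open import Data.Nat.Combinatorics using (_C_; k![n∸k]!∣n!)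
  open import Data.Nat.Combinatorics.Specification using (nCk≡n!/k![n-k]!)
  open import Data.Nat.DivMod using (m/n*n≡m)
  import Data.Nat.Tactic.RingSolver as ℕSolver
  open import Data.Integer using (ℤ; +_; _*_; _-_; _+_; -_; ∣_∣)
  import Data.Integer.Properties as ℤP
  open import Data.Integer.Divisibility using (_∣_)
  import Data.Integer.Divisibility.Signed as S
  open import Data.Integer.Coprimality using (Coprime; coprime-divisor)
  open import Data.Integer.Tactic.RingSolver using (solve-∀)
  open ≡ using (refl; sym; trans; cong; cong₂; subst; module ≡-Reasoning)

  n∣n! : ∀ {n} → .{{ℕ.NonZero n}} → n ℕ∣.∣ n !
  n∣n! {suc n} = ℕ∣.m∣m*n (n !)

  bézout-inverse : ∀ {s m} → 1 ℕ.≤ s → gcd s m ≡ 1 → ∃₂ λ u v → s ℕ.* u ≡ 1 ℕ.+ v ℕ.* m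
  bézout-inverse {s} {m} s≥1 gcd≡1 with ℕC.coprime-Bézout (ℕC.gcd≡1⇒coprime gcd≡1)
  ... | Bézout.+- x y eq = x , y , trans (ℕP.*-comm s x) (sym eq)
  bézout-inverse {suc s₁} {zero}   _ _ | Bézout.-+ x y eq = contradiction (trans eq (ℕP.*-zeroʳ y)) λ ()
  bézout-inverse {suc s₁} {suc m₁} _ _ | Bézout.-+ x y eq =
    x ℕ.* m₁ ℕ.+ suc m₁ , y ℕ.* m₁ ℕ.+ s₁ , ℕP.+-cancelʳ-≡ m₁ _ _ (begin
      s ℕ.* (x ℕ.* m₁ ℕ.+ suc m₁) ℕ.+ m₁           ≡⟨ expand x m₁ s₁ ⟩
      (1 ℕ.+ x ℕ.* s) ℕ.* m₁ ℕ.+ s ℕ.* suc m₁       ≡⟨ cong (λ w → w ℕ.* m₁ ℕ.+ s ℕ.* suc m₁) eq ⟩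
      y ℕ.* suc m₁ ℕ.* m₁ ℕ.+ s ℕ.* suc m₁         ≡⟨ regroup y m₁ s₁ ⟩
      1 ℕ.+ (y ℕ.* m₁ ℕ.+ s₁) ℕ.* suc m₁ ℕ.+ m₁    ∎)
    where
    open ≡-Reasoning
    s : ℕ
    s = suc s₁
    expand : ∀ x m₁ s₁ → suc s₁ ℕ.* (x ℕ.* m₁ ℕ.+ suc m₁) ℕ.+ m₁
                       ≡ (1 ℕ.+ x ℕ.* suc s₁) ℕ.* m₁ ℕ.+ suc s₁ ℕ.* suc m₁
    expand = ℕSolver.solve-∀
    regroup : ∀ y m₁ s₁ → y ℕ.* suc m₁ ℕ.* m₁ ℕ.+ suc s₁ ℕ.* suc m₁
                        ≡ 1 ℕ.+ (y ℕ.* m₁ ℕ.+ s₁) ℕ.* suc m₁ ℕ.+ m₁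
    regroup = ℕSolver.solve-∀

  ∣-* : ∀ {a b c d} → a S.∣ b → c S.∣ d → a * c S.∣ b * d
  ∣-* {a} {c = c} (S.divides k refl) (S.divides l refl) = S.divides (k * l) (regroup k a l c)
    where
    regroup : ∀ k a l c → k * a * (l * c) ≡ k * l * (a * c)
    regroup = solve-∀

  module _ {p : ℕ} (p-prime : Prime p) where

    coprime-prime-power : ∀ {m} → ¬ p ℕ∣.∣ m → ∀ n → ℕC.Coprime m (p ℕ.^ n)
    coprime-prime-power p∤m zero    (_ , d∣1)      = ℕ∣.∣1⇒≡1 d∣1
    coprime-prime-power p∤m (suc n) (d∣m , d∣p^n+1) =
      coprime-prime-power p∤m n (d∣m , ℕC.coprime-divisor d⊥p d∣p^n+1)
      where
      d⊥p : ℕC.Coprime _ p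
      d⊥p (e∣d , e∣p) with prime⇒irreducible p-prime e∣p
      ... | inj₁ e≡1 = e≡1
      ... | inj₂ refl = ⊥-elim (p∤m (ℕ∣.∣-trans e∣d d∣m))

    prime∤factorial : ∀ {m} → m ℕ.< p → ¬ p ℕ∣.∣ m !
    prime∤factorial {zero}  _   p∣1  = ¬prime[1] (subst Prime (ℕ∣.∣1⇒≡1 p∣1) p-prime)
    prime∤factorial {suc m} m<p p∣m! with euclidsLemma (suc m) (m !) p-prime p∣m!
    ... | inj₁ p∣m = ℕP.<⇒≱ m<p (ℕ∣.∣⇒≤ p∣m)
    ... | inj₂ p∣m! = prime∤factorial (ℕP.<-trans (ℕP.n<1+n m) m<p) p∣m!

    prime∣binomial : ∀ {k} → 0 ℕ.< k → k ℕ.< p → p ℕ∣.∣ p C k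
    prime∣binomial {k} 0<k k<p
      with euclidsLemma (p C k) (k ! ℕ.* (p ℕ.∸ k) !) p-prime p∣product
      where
      instance _ = prime⇒nonZero p-prime
      p∣product : p ℕ∣.∣ (p C k) ℕ.* (k ! ℕ.* (p ℕ.∸ k) !)
      p∣product = subst (p ℕ∣.∣_) (sym (trans (cong (ℕ._* (k ! ℕ.* (p ℕ.∸ k) !)) (nCk≡n!/k![n-k]! (ℕP.<⇒≤ k<p)))
                                              (m/n*n≡m {{ℕP._!*_!≢0 k (p ℕ.∸ k)}} (k![n∸k]!∣n! (ℕP.<⇒≤ k<p)))))
                        (n∣n! {p})
    ... | inj₁ p∣pCk = p∣pCk
    ... | inj₂ p∣k![p-k]! with euclidsLemma (k !) ((p ℕ.∸ k) !) p-prime p∣k![p-k]!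
    ...   | inj₁ p∣k! = contradiction p∣k! (prime∤factorial k<p)
    ...   | inj₂ p∣[p-k]! = contradiction p∣[p-k]! (prime∤factorial (ℕP.∸-monoʳ-< 0<k (ℕP.<⇒≤ k<p)))

    prime∤* : ∀ {x y} → ¬ (+ p ∣ x) → ¬ (+ p ∣ y) → ¬ (+ p ∣ x * y)
    prime∤* {x} {y} p∤x p∤y p∣xy
      with euclidsLemma ∣ x ∣ ∣ y ∣ p-prime (subst (p ℕ∣.∣_) (ℤP.abs-* x y) p∣xy)
    ... | inj₁ p∣x = p∤x p∣x
    ... | inj₂ p∣y = p∤y p∣y

    ∣-cancel-prime-power : ∀ {x y} n → ¬ (+ p ∣ x) → x S.∣ + (p ℕ.^ n) * y → x ∣ y
    ∣-cancel-prime-power {x} {y} n p∤x x∣p^ny =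
      coprime-divisor x (+ (p ℕ.^ n)) y (coprime-prime-power p∤x n) (S.∣⇒∣ᵤ x∣p^ny)

    coprime-of-common-divisors : ∀ {A B nA nB : ℤ} n → A * nA + B * nB ≡ + (p ℕ.^ n) →
      ∀ {x y} → ¬ (+ p ∣ x) →
      (∀ {d} → + d S.∣ x → + d S.∣ y → + d S.∣ A × + d S.∣ B) → Coprime x y
    coprime-of-common-divisors {A} {B} {nA} {nB} n first p∤x common {d} (d∣x , d∣y) =
      coprime-prime-power p∤d n (ℕ∣.∣-refl , S.∣⇒∣ᵤ d∣p^n)
      where
      p∤d : ¬ p ℕ∣.∣ d
      p∤d p∣d = p∤x (ℕ∣.∣-trans p∣d d∣x)
      d∣p^n : + d S.∣ + (p ℕ.^ n)
      d∣p^n with common (S.∣ᵤ⇒∣ d∣x) (S.∣ᵤ⇒∣ d∣y)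
      ... | d∣A , d∣B = subst (+ d S.∣_) first (S.∣m∣n⇒∣m+n (S.∣m⇒∣m*n nA d∣A) (S.∣m⇒∣m*n nB d∣B))

    moment-factorisation : ∀ {A B nA nB : ℤ} n → let Q = + (p ℕ.^ n) in
      A * nA + B * nB ≡ Q → A * A * nA + B * B * nB ≡ Q * Q → A * (A - B) * nA ≡ Q * (Q - B)
    moment-factorisation {A} {B} {nA} {nB} n first second = begin
      A * (A - B) * nA                                    ≡⟨ expand A B nA nB ⟩
      (A * A * nA + B * B * nB) - B * (A * nA + B * nB)   ≡⟨ cong₂ (λ u v → u - B * v) second first ⟩
      Q * Q - B * Q                                       ≡⟨ factor Q B ⟩
      Q * (Q - B)                                         ∎
      where
      open ≡-Reasoning
      Q : ℤ
      Q = + (p ℕ.^ n)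
      expand : ∀ A B nA nB → A * (A - B) * nA ≡ (A * A * nA + B * B * nB) - B * (A * nA + B * nB)
      expand = solve-∀
      factor : ∀ Q B → Q * Q - B * Q ≡ Q * (Q - B)
      factor = solve-∀

    divisibility-from-moments : ∀ {A B nA nB : ℤ} {n : ℕ} →
      A * nA + B * nB ≡ + (p ℕ.^ n) →
      A * A * nA + B * B * nB ≡ + (p ℕ.^ n) * + (p ℕ.^ n) →
      (ea eb ec : ℕ) (α β γ : ℤ) →
      A ≡ + (p ℕ.^ ea) * α → B ≡ + (p ℕ.^ eb) * β → A - B ≡ + (p ℕ.^ ec) * γ →
      ¬ (+ p ∣ α) → ¬ (+ p ∣ β) → ¬ (+ p ∣ γ) →
      Coprime α β × Coprime α γ × Coprime β γ ×
      (α * γ ∣ + (p ℕ.^ n) - B) × (β * γ ∣ + (p ℕ.^ n) - A)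
    divisibility-from-moments {A} {B} {nA} {nB} {n} first second ea eb ec α β γ A≡ B≡ A-B≡ p∤α p∤β p∤γ =
      α⊥β , α⊥γ , β⊥γ , αγ∣Q-B , βγ∣Q-A
      where
      Q : ℤ
      Q = + (p ℕ.^ n)
      α∣A : α S.∣ A
      α∣A = S.divides (+ (p ℕ.^ ea)) A≡
      β∣B : β S.∣ B
      β∣B = S.divides (+ (p ℕ.^ eb)) B≡
      γ∣A-B : γ S.∣ A - B
      γ∣A-B = S.divides (+ (p ℕ.^ ec)) A-B≡
      γ∣B-A : γ S.∣ B - A
      γ∣B-A = subst (γ S.∣_) (sym (neg-sub A B)) (S.∣m⇒∣-m γ∣A-B)
        where
        neg-sub : ∀ A B → B - A ≡ - (A - B)
        neg-sub = solve-∀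

      B≡A-[A-B] : ∀ A B → A - (A - B) ≡ B
      B≡A-[A-B] = solve-∀
      A≡[A-B]+B : ∀ A B → (A - B) + B ≡ A
      A≡[A-B]+B = solve-∀

      α⊥β : Coprime α β
      α⊥β = coprime-of-common-divisors n first p∤α λ d∣α d∣β →
        S.∣-trans d∣α α∣A , S.∣-trans d∣β β∣B
      α⊥γ : Coprime α γ
      α⊥γ = coprime-of-common-divisors n first p∤α λ d∣α d∣γ →
        let d∣A = S.∣-trans d∣α α∣A in
        d∣A , subst (_ S.∣_) (B≡A-[A-B] A B) (S.∣m∣n⇒∣m-n d∣A (S.∣-trans d∣γ γ∣A-B))
      β⊥γ : Coprime β γ
      β⊥γ = coprime-of-common-divisors n first p∤β λ d∣β d∣γ →
        let d∣B = S.∣-trans d∣β β∣B in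
        subst (_ S.∣_) (A≡[A-B]+B A B) (S.∣m∣n⇒∣m+n (S.∣-trans d∣γ γ∣A-B) d∣B) , d∣B

      αγ∣Q-B : α * γ ∣ Q - B
      αγ∣Q-B = ∣-cancel-prime-power {α * γ} {Q - B} n (prime∤* {α} {γ} p∤α p∤γ)
        (subst (α * γ S.∣_) (moment-factorisation {A} {B} {nA} {nB} n first second)
          (S.∣m⇒∣m*n nA (∣-* α∣A γ∣A-B)))
      βγ∣Q-A : β * γ ∣ Q - A
      βγ∣Q-A = ∣-cancel-prime-power {β * γ} {Q - A} n (prime∤* {β} {γ} p∤β p∤γ)
        (subst (β * γ S.∣_) (moment-factorisation {B} {A} {nB} {nA} n first′ second′)
          (S.∣m⇒∣m*n nB (∣-* β∣B γ∣B-A)))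
        where
        first′ : B * nB + A * nA ≡ Q
        first′ = trans (ℤP.+-comm (B * nB) (A * nA)) first
        second′ : B * B * nB + A * A * nA ≡ Q * Q
        second′ = trans (ℤP.+-comm (B * B * nB) (A * A * nA)) second


module FieldProperties (L : FiniteField) where

  open FiniteField L
  open import Data.Fin.Permutation using (Permutation; permutation)
  open import Relation.Binary.Reasoning.Setoid setoid
  open import Algebra.Properties.Semiring.Exp semiring using (^-congˡ)
  open import Algebra.Properties.CommutativeSemiring.Exp commutativeSemiring using (^-distrib-*)
  import Algebra.Properties.Group +-group as +-Group
  open import Algebra.Properties.CommutativeSemigroup +-commutativeSemigroup using (interchange)

  _⁻¹[_] : ∀ x → ¬ x ≈ 0# → Carrier
  x ⁻¹[ x≉0 ] = proj₁ (inverse x x≉0)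

  *-inverseʳ : ∀ x (x≉0 : ¬ x ≈ 0#) → x * x ⁻¹[ x≉0 ] ≈ 1#
  *-inverseʳ x x≉0 = proj₂ (inverse x x≉0)

  *-inverseˡ : ∀ x (x≉0 : ¬ x ≈ 0#) → x ⁻¹[ x≉0 ] * x ≈ 1#
  *-inverseˡ x x≉0 = trans (*-comm _ _) (*-inverseʳ x x≉0)

  *-cancelˡ : ∀ {z x y} → ¬ z ≈ 0# → z * x ≈ z * y → x ≈ y
  *-cancelˡ {z} {x} {y} z≉0 zx≈zy = begin
    x                      ≈⟨ *-identityˡ x ⟨
    1# * x                 ≈⟨ *-congʳ (*-inverseˡ z z≉0) ⟨
    (z ⁻¹[ z≉0 ] * z) * x  ≈⟨ *-assoc _ _ _ ⟩
    z ⁻¹[ z≉0 ] * (z * x)  ≈⟨ *-congˡ zx≈zy ⟩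
    z ⁻¹[ z≉0 ] * (z * y)  ≈⟨ *-assoc _ _ _ ⟨
    (z ⁻¹[ z≉0 ] * z) * y  ≈⟨ *-congʳ (*-inverseˡ z z≉0) ⟩
    1# * y                 ≈⟨ *-identityˡ y ⟩
    y                      ∎

  *-nonzero : ∀ {x y} → ¬ x ≈ 0# → ¬ y ≈ 0# → ¬ x * y ≈ 0#
  *-nonzero x≉0 y≉0 xy≈0 = y≉0 (*-cancelˡ x≉0 (trans xy≈0 (sym (zeroʳ _))))

  1^ : ∀ k → 1# ^ k ≈ 1#
  1^ zero    = refl
  1^ (suc k) = trans (*-identityˡ _) (1^ k)

  0^-nonzero : ∀ {k} → k ≢ 0 → 0# ^ k ≈ 0#
  0^-nonzero {zero}  k≢0 = contradiction ≡.refl k≢0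
  0^-nonzero {suc k} _   = zeroˡ _

  ^-fixed-⁻¹ : ∀ {z} (z≉0 : ¬ z ≈ 0#) e → z ^ e ≈ z → z ⁻¹[ z≉0 ] ^ e ≈ z ⁻¹[ z≉0 ]
  ^-fixed-⁻¹ {z} z≉0 e z^e≈z = *-cancelˡ z≉0 (begin
    z * z⁻¹ ^ e       ≈⟨ *-congʳ z^e≈z ⟨
    z ^ e * z⁻¹ ^ e   ≈⟨ ^-distrib-* z z⁻¹ e ⟨
    (z * z⁻¹) ^ e     ≈⟨ ^-congˡ e (*-inverseʳ z z≉0) ⟩
    1# ^ e            ≈⟨ 1^ e ⟩
    1#                ≈⟨ *-inverseʳ z z≉0 ⟨
    z * z⁻¹           ∎)
    where
    z⁻¹ : Carrier
    z⁻¹ = z ⁻¹[ z≉0 ]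

  index : Carrier → Fin order
  index x = proj₁ (enum-surj x)

  enum-index : ∀ x → enum (index x) ≈ x
  enum-index x = proj₂ (enum-surj x)

  enum-injective : ∀ {i j} → enum i ≈ enum j → i ≡ j
  enum-injective = enum-inj _ _

  order≢0 : order ≢ 0
  order≢0 q≡0 = FinP.¬Fin0 (≡.subst Fin q≡0 (index 0#))

  *-permutation : ∀ {z} → ¬ z ≈ 0# → Inverse setoid setoid
  *-permutation {z} z≉0 = mkInverse setoid (z *_) (z ⁻¹[ z≉0 ] *_) *-congˡ *-congˡ
    (λ y → trans (sym (*-assoc _ _ _)) (trans (*-congʳ (*-inverseʳ z z≉0)) (*-identityˡ y)))
    (λ x → trans (sym (*-assoc _ _ _)) (trans (*-congʳ (*-inverseˡ z z≉0)) (*-identityˡ x)))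

  +-permutation : Carrier → Inverse setoid setoid
  +-permutation w = mkInverse setoid (_+ w) (_- w) +-congʳ +-congʳ
    (λ y → trans (+-assoc _ _ _) (trans (+-congˡ (-‿inverseˡ w)) (+-identityʳ y)))
    (λ x → trans (+-assoc _ _ _) (trans (+-congˡ (-‿inverseʳ w)) (+-identityʳ x)))

  enumeration-permutation : Inverse setoid setoid → Permutation order order
  enumeration-permutation π = permutation (λ i → index (to (enum i))) (λ i → index (from (enum i)))
    (λ i → enum-injective (trans (enum-index _) (trans (to-cong (enum-index _)) (strictlyInverseˡ (enum i)))))
    (λ i → enum-injective (trans (enum-index _) (trans (from-cong (enum-index _)) (strictlyInverseʳ (enum i)))))
    where open Inverse π

  module _ {c ℓ} (M : CommutativeMonoid c ℓ) where

    private
      module M = CommutativeMonoid M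
    open import Algebra.Properties.CommutativeMonoid.Sum M using (sum; sum-permute; sum-cong-≋)

    ∑ᴸ : (Carrier → M.Carrier) → M.Carrier
    ∑ᴸ f = sum (λ i → f (enum i))

    ∑ᴸ-permute : (π : Inverse setoid setoid) (f : Carrier → M.Carrier) →
                 (∀ {x y} → x ≈ y → f x M.≈ f y) → ∑ᴸ f M.≈ ∑ᴸ (λ x → f (Inverse.to π x))
    ∑ᴸ-permute π f f-cong = M.trans (sum-permute (λ i → f (enum i)) (enumeration-permutation π))
                                     (sum-cong-≋ (λ i → f-cong (enum-index (Inverse.to π (enum i)))))

  Σᴸ-map-cong : ∀ {A : Set} {f g : A → Carrier} xs → (∀ a → f a ≈ g a) →
                Σᴸ L (List.map f xs) ≈ Σᴸ L (List.map g xs)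
  Σᴸ-map-cong []       f≈g = refl
  Σᴸ-map-cong (a ∷ xs) f≈g = +-cong (f≈g a) (Σᴸ-map-cong xs f≈g)

  Σᴸ-map-+ : ∀ {A : Set} (f g : A → Carrier) xs →
             Σᴸ L (List.map (λ a → f a + g a) xs) ≈ Σᴸ L (List.map f xs) + Σᴸ L (List.map g xs)
  Σᴸ-map-+ f g []       = sym (+-identityˡ 0#)
  Σᴸ-map-+ f g (a ∷ xs) = trans (+-congˡ (Σᴸ-map-+ f g xs)) (interchange _ _ _ _)

  Σᴸ-map-*ˡ : ∀ {A : Set} c (f : A → Carrier) xs →
              Σᴸ L (List.map (λ a → c * f a) xs) ≈ c * Σᴸ L (List.map f xs)
  Σᴸ-map-*ˡ c f []       = sym (zeroʳ c)
  Σᴸ-map-*ˡ c f (a ∷ xs) = trans (+-congˡ (Σᴸ-map-*ˡ c f xs)) (sym (distribˡ c _ _))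

  Σᴸ-∷ʳ : ∀ xs x → Σᴸ L (xs List.∷ʳ x) ≈ Σᴸ L xs + x
  Σᴸ-∷ʳ []       x = trans (+-identityʳ x) (sym (+-identityˡ x))
  Σᴸ-∷ʳ (y ∷ xs) x = trans (+-congˡ (Σᴸ-∷ʳ xs x)) (sym (+-assoc y _ x))

  Σᴸ-rotate : ∀ (g : ℕ → Carrier) n → g n ≈ g 0 →
              Σᴸ L (List.applyUpTo (g ∘ suc) n) ≈ Σᴸ L (List.applyUpTo g n)
  Σᴸ-rotate g n gₙ≈g₀ = +-Group.∙-cancelˡ (g 0) _ _ (begin
    Σᴸ L (List.applyUpTo g (suc n))          ≡⟨ ≡.cong (Σᴸ L) (ListP.applyUpTo-∷ʳ g n) ⟨
    Σᴸ L (List.applyUpTo g n List.∷ʳ g n)    ≈⟨ Σᴸ-∷ʳ (List.applyUpTo g n) (g n) ⟩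
    Σᴸ L (List.applyUpTo g n) + g n          ≈⟨ +-comm _ _ ⟩
    g n + Σᴸ L (List.applyUpTo g n)          ≈⟨ +-congʳ gₙ≈g₀ ⟩
    g 0 + Σᴸ L (List.applyUpTo g n)          ∎)

module Fermat (L : FiniteField) where

  open FiniteField L
  open FieldProperties L
  open import Relation.Binary.Reasoning.Setoid setoid
  open import Algebra.Properties.Semiring.Exp semiring using (^-congˡ; ^-assocʳ)
  import Algebra.Properties.CommutativeMonoid.Sum *-commutativeMonoid as Product

  private
    ∏ᴸ : (Carrier → Carrier) → Carrier
    ∏ᴸ = ∑ᴸ *-commutativeMonoid

  product-nonzero : ∀ {n} (f : Fin n → Carrier) → (∀ i → ¬ f i ≈ 0#) → ¬ Product.sum f ≈ 0#
  product-nonzero {zero}  f f≉0 = 1≉0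
  product-nonzero {suc n} f f≉0 = *-nonzero (f≉0 Fin.zero) (product-nonzero (f ∘ Fin.suc) (f≉0 ∘ Fin.suc))

  unit-part : Carrier → Carrier
  unit-part x with x ≟ 0#
  ... | yes _ = 1#
  ... | no  _ = x

  unit-part-nonzero : ∀ x → ¬ unit-part x ≈ 0#
  unit-part-nonzero x with x ≟ 0#
  ... | yes _   = 1≉0
  ... | no  x≉0 = x≉0

  unit-part-cong : ∀ {x y} → x ≈ y → unit-part x ≈ unit-part y
  unit-part-cong {x} {y} x≈y with x ≟ 0# | y ≟ 0#
  ... | yes _   | yes _   = refl
  ... | yes x≈0 | no  y≉0 = contradiction (trans (sym x≈y) x≈0) y≉0
  ... | no  x≉0 | yes y≈0 = contradiction (trans x≈y y≈0) x≉0
  ... | no  _   | no  _   = x≈y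

  -- x ↦ z x permutes L, so ∏ₓ z·unit-part x and ∏ₓ unit-part (z x) agree up to the factor z
  -- contributed by x = 0; the left-hand side is z^q ∏ₓ unit-part x.
  fermat-nonzero : ∀ {z} → ¬ z ≈ 0# → z ^ order ≈ z
  fermat-nonzero {z} z≉0 = *-cancelˡ unit-part-nonzero-product (trans (*-comm _ _) scaled)
    where
    unit-part-nonzero-product : ¬ ∏ᴸ unit-part ≈ 0#
    unit-part-nonzero-product = product-nonzero _ (λ i → unit-part-nonzero (enum i))
    defect : Carrier → Carrier
    defect x with x ≟ 0#
    ... | yes _ = z
    ... | no  _ = 1#
    scale-unit-part : ∀ x → z * unit-part x ≈ unit-part (z * x) * defect x
    scale-unit-part x with x ≟ 0# | (z * x) ≟ 0#
    ... | yes _   | yes _    = trans (*-identityʳ z) (sym (*-identityˡ z))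
    ... | yes x≈0 | no  zx≉0 = contradiction (trans (*-congˡ x≈0) (zeroʳ z)) zx≉0
    ... | no  x≉0 | yes zx≈0 = contradiction zx≈0 (*-nonzero z≉0 x≉0)
    ... | no  _   | no  _    = sym (*-identityʳ _)
    ∏-defect : ∏ᴸ defect ≈ z
    ∏-defect = trans (sum-supported-at *-commutativeMonoid _ (index 0#) off-zero) at-zero
      where
      off-zero : ∀ i → i ≢ index 0# → defect (enum i) ≈ 1#
      off-zero i i≢0 with enum i ≟ 0#
      ... | yes eᵢ≈0 = contradiction (enum-injective (trans eᵢ≈0 (sym (enum-index 0#)))) i≢0
      ... | no  _    = refl
      at-zero : defect (enum (index 0#)) ≈ z
      at-zero with enum (index 0#) ≟ 0#
      ... | yes _  = refl
      ... | no e≉0 = contradiction (enum-index 0#) e≉0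
    scaled : z ^ order * ∏ᴸ unit-part ≈ ∏ᴸ unit-part * z
    scaled = begin
      z ^ order * ∏ᴸ unit-part                          ≈⟨ *-congʳ (Product.sum-replicate order) ⟨
      ∏ᴸ (λ _ → z) * ∏ᴸ unit-part                       ≈⟨ Product.∑-distrib-+ (λ _ → z) (unit-part ∘ enum) ⟨
      ∏ᴸ (λ x → z * unit-part x)                        ≈⟨ Product.sum-cong-≋ (scale-unit-part ∘ enum) ⟩
      ∏ᴸ (λ x → unit-part (z * x) * defect x)           ≈⟨ Product.∑-distrib-+ (λ i → unit-part (z * enum i)) (defect ∘ enum) ⟩
      ∏ᴸ (λ x → unit-part (z * x)) * ∏ᴸ defect
        ≈⟨ *-cong (sym (∑ᴸ-permute *-commutativeMonoid (*-permutation z≉0) unit-part unit-part-cong)) ∏-defect ⟩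
      ∏ᴸ unit-part * z                                  ∎

  fermat : ∀ z → z ^ order ≈ z
  fermat z with z ≟ 0#
  ... | yes z≈0 = trans (^-congˡ order z≈0) (trans (0^-nonzero order≢0) (sym z≈0))
  ... | no  z≉0 = fermat-nonzero z≉0

  fermat-unit : ∀ {z} → ¬ z ≈ 0# → z ^ (order ℕ.∸ 1) ≈ 1#
  fermat-unit {z} z≉0 = *-cancelˡ z≉0 (begin
    z * z ^ (order ℕ.∸ 1)   ≡⟨ ≡.cong (z ^_) (suc[m∸1]≡m order≢0) ⟩
    z ^ order               ≈⟨ fermat-nonzero z≉0 ⟩
    z                       ≈⟨ *-identityʳ z ⟨
    z * 1#                  ∎)
    where
    suc[m∸1]≡m : ∀ {m} → m ≢ 0 → suc (m ℕ.∸ 1) ≡ m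
    suc[m∸1]≡m {zero}  m≢0 = contradiction ≡.refl m≢0
    suc[m∸1]≡m {suc m} _   = ≡.refl

  ^-permutation : ∀ {s} → 1 ℕ.≤ s → gcd s (order ℕ.∸ 1) ≡ 1 → Inverse setoid setoid
  ^-permutation {s} s≥1 gcd≡1 = mkInverse setoid (_^ s) (_^ u) (^-congˡ s) (^-congˡ u)
    (λ y → trans (^-assocʳ y u s) (trans (reflexive (≡.cong (y ^_) (ℕP.*-comm u s))) (^[su] y)))
    (λ x → trans (^-assocʳ x s u) (^[su] x))
    where
    inverse-exponent : ∃₂ λ u v → s ℕ.* u ≡ 1 ℕ.+ v ℕ.* (order ℕ.∸ 1)
    inverse-exponent = PrimeDivisibility.bézout-inverse s≥1 gcd≡1
    u v : ℕ
    u = proj₁ inverse-exponent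
    v = proj₁ (proj₂ inverse-exponent)
    su≡1+v[q-1] : s ℕ.* u ≡ 1 ℕ.+ v ℕ.* (order ℕ.∸ 1)
    su≡1+v[q-1] = proj₂ (proj₂ inverse-exponent)
    ^[su] : ∀ x → x ^ (s ℕ.* u) ≈ x
    ^[su] x with x ≟ 0#
    ... | yes x≈0 = trans (^-congˡ (s ℕ.* u) x≈0)
                      (trans (0^-nonzero (λ su≡0 → contradiction (≡.trans (≡.sym su≡0) su≡1+v[q-1]) λ ()))
                             (sym x≈0))
    ... | no  x≉0 = begin
      x ^ (s ℕ.* u)                       ≡⟨ ≡.cong (x ^_) (≡.trans su≡1+v[q-1] (≡.cong suc (ℕP.*-comm v _))) ⟩
      x * x ^ ((order ℕ.∸ 1) ℕ.* v)       ≈⟨ *-congˡ (^-assocʳ x (order ℕ.∸ 1) v) ⟨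
      x * (x ^ (order ℕ.∸ 1)) ^ v         ≈⟨ *-congˡ (^-congˡ v (fermat-unit x≉0)) ⟩
      x * 1# ^ v                          ≈⟨ *-congˡ (1^ v) ⟩
      x * 1#                              ≈⟨ *-identityʳ x ⟩
      x                                   ∎


module MonicPolynomials (L : FiniteField) where

  open FiniteField L
  open import Data.Vec using (Vec; []; _∷_)
  open FieldProperties L
  open import Relation.Binary.Reasoning.Setoid setoid
  import Algebra.Properties.Group +-group as +-Group
  open import Algebra.Solver.Ring.NaturalCoefficients.Default commutativeSemiring using (solve; _:=_; _:+_; _:*_; con)

  -- evalMonic (c₀ ∷ c₁ ∷ ⋯ ∷ c_{d−1}) x = c₀ + c₁ x + ⋯ + c_{d−1} x^{d−1} + x^d.
  evalMonic : ∀ {d} → Vec Carrier d → Carrier → Carrier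
  evalMonic []       x = 1#
  evalMonic (c ∷ cs) x = c + x * evalMonic cs x

  synthetic-division : ∀ {d} → Vec Carrier (suc d) → Carrier → Vec Carrier d
  synthetic-division (c ∷ [])      r = []
  synthetic-division (c ∷ c′ ∷ cs) r = evalMonic (c′ ∷ cs) r ∷ synthetic-division (c′ ∷ cs) r

  -- The semiring solver treats - r as an atom, so r - r ≈ 0 is inserted by hand.
  synthetic-division-correct : ∀ {d} (f : Vec Carrier (suc d)) x r →
    evalMonic f x ≈ (x - r) * evalMonic (synthetic-division f r) x + evalMonic f r
  synthetic-division-correct (c ∷ []) x r = begin
    c + x * 1#                       ≈⟨ +-identityʳ _ ⟨
    (c + x * 1#) + 0#                ≈⟨ +-congˡ (trans (*-congʳ (-‿inverseʳ r)) (zeroˡ 1#)) ⟨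
    (c + x * 1#) + (r - r) * 1#      ≈⟨ solve 4 (λ c x r r⁻ → (c :+ x :* con 1) :+ (r :+ r⁻) :* con 1
                                                 := (x :+ r⁻) :* con 1 :+ (c :+ r :* con 1)) refl c x r (- r) ⟩
    (x - r) * 1# + (c + r * 1#)      ∎
  synthetic-division-correct {suc d} (c ∷ c′ ∷ cs) x r = begin
    c + x * evalMonic f x                       ≈⟨ +-congˡ (*-congˡ (synthetic-division-correct f x r)) ⟩
    c + x * ((x - r) * g + fr)                  ≈⟨ +-identityʳ _ ⟨
    (c + x * ((x - r) * g + fr)) + 0#           ≈⟨ +-congˡ (trans (*-congʳ (-‿inverseʳ r)) (zeroˡ fr)) ⟨
    (c + x * ((x - r) * g + fr)) + (r - r) * fr
      ≈⟨ solve 6 (λ c x r r⁻ g fr → (c :+ x :* ((x :+ r⁻) :* g :+ fr)) :+ (r :+ r⁻) :* fr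
                                 := (x :+ r⁻) :* (fr :+ x :* g) :+ (c :+ r :* fr)) refl c x r (- r) g fr ⟩
    (x - r) * (fr + x * g) + (c + r * fr)       ∎
    where
    f : Vec Carrier (suc d)
    f = c′ ∷ cs
    g fr : Carrier
    g = evalMonic (synthetic-division f r) x
    fr = evalMonic f r

  monic-root-bound : ∀ {d} (f : Vec Carrier d) (ρ : Fin (suc d) → Carrier) →
    Injective _≡_ _≈_ ρ → ¬ (∀ i → evalMonic f (ρ i) ≈ 0#)
  monic-root-bound []          ρ ρ-inj roots = 1≉0 (roots Fin.zero)
  monic-root-bound f@(_ ∷ _) ρ ρ-inj roots =
    monic-root-bound (synthetic-division f r) (ρ ∘ Fin.suc) (FinP.suc-injective ∘ ρ-inj) roots′
    where
    r : Carrier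
    r = ρ Fin.zero
    roots′ : ∀ i → evalMonic (synthetic-division f r) (ρ (Fin.suc i)) ≈ 0#
    roots′ i = *-cancelˡ ρᵢ-r≉0 (begin
      (ρᵢ - r) * evalMonic (synthetic-division f r) ρᵢ           ≈⟨ +-identityʳ _ ⟨
      (ρᵢ - r) * evalMonic (synthetic-division f r) ρᵢ + 0#      ≈⟨ +-congˡ (roots Fin.zero) ⟨
      (ρᵢ - r) * evalMonic (synthetic-division f r) ρᵢ + evalMonic f r ≈⟨ synthetic-division-correct f ρᵢ r ⟨
      evalMonic f ρᵢ                                            ≈⟨ roots (Fin.suc i) ⟩
      0#                                                        ≈⟨ zeroʳ _ ⟨
      (ρᵢ - r) * 0#                                             ∎)
      where
      ρᵢ : Carrier
      ρᵢ = ρ (Fin.suc i)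
      ρᵢ-r≉0 : ¬ ρᵢ - r ≈ 0#
      ρᵢ-r≉0 ρᵢ-r≈0 with ρ-inj (+-Group.x∙y⁻¹≈ε⇒x≈y _ _ ρᵢ-r≈0)
      ... | ()


module Counting (L : FiniteField) where

  open FiniteField L using (Carrier; order; enum)
  open FieldProperties L using (∑ᴸ)
  open import Data.Integer using (ℤ; +_; _+_)
  import Data.Integer.Properties as ℤP
  open import Data.Bool using (if_then_else_)
  open import Relation.Nullary using (Dec; does)
  open import Relation.Nullary.Decidable using (dec-true; dec-false; does-⇔)
  open import Function.Bundles using (_⇔_)
  import Data.Nat.ListAction as ℕList
  open IntegerSums using (sum; sum-cong-≋; sum-const)
  open ≡ using (refl; trans; cong)

  ∑ : (Carrier → ℤ) → ℤ
  ∑ = ∑ᴸ ℤP.+-0-commutativeMonoid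

  𝟙 : ∀ {A : Set} → Dec A → ℤ
  𝟙 a? = + (if does a? then 1 else 0)

  𝟙-yes : ∀ {A : Set} (a? : Dec A) → A → 𝟙 a? ≡ + 1
  𝟙-yes a? a = cong (λ b → + (if b then 1 else 0)) (dec-true a? a)

  𝟙-no : ∀ {A : Set} (a? : Dec A) → ¬ A → 𝟙 a? ≡ + 0
  𝟙-no a? ¬a = cong (λ b → + (if b then 1 else 0)) (dec-false a? ¬a)

  𝟙-⇔ : ∀ {A B : Set} (a? : Dec A) (b? : Dec B) → A ⇔ B → 𝟙 a? ≡ 𝟙 b?
  𝟙-⇔ a? b? A⇔B = cong (λ b → + (if b then 1 else 0)) (does-⇔ A⇔B a? b?)

  ∑-1 : ∑ (λ _ → + 1) ≡ + order
  ∑-1 = trans (sum-const order (+ 1)) (ℤP.*-identityʳ (+ order))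

  ∑-𝟙-all : ∀ {P : Carrier → Set} (P? : ∀ x → Dec (P x)) → (∀ x → P x) → ∑ (λ x → 𝟙 (P? x)) ≡ + order
  ∑-𝟙-all P? all = trans (sum-cong-≋ (λ i → 𝟙-yes (P? (enum i)) (all (enum i)))) ∑-1

  ∑-𝟙-none : ∀ {P : Carrier → Set} (P? : ∀ x → Dec (P x)) → (∀ x → ¬ P x) → ∑ (λ x → 𝟙 (P? x)) ≡ + 0
  ∑-𝟙-none P? none = trans (sum-cong-≋ (λ i → 𝟙-no (P? (enum i)) (none (enum i))))
                           (trans (sum-const order (+ 0)) (ℤP.*-zeroʳ (+ order)))

  countL≡∑ : ∀ (P : Carrier → Set) (P? : ∀ x → Dec (P x)) → + countL L P P? ≡ ∑ (λ x → 𝟙 (P? x))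
  countL≡∑ P P? = trans (cong (λ xs → + ℕList.sum xs) (ListP.map-tabulate (λ i → i) indicator))
                        (pos-sum-tabulate indicator)
    where
    indicator : Fin order → ℕ
    indicator i = if does (P? (enum i)) then 1 else 0
    pos-sum-tabulate : ∀ {m} (h : Fin m → ℕ) → + ℕList.sum (List.tabulate h) ≡ sum (λ i → + h i)
    pos-sum-tabulate {zero}  h = refl
    pos-sum-tabulate {suc m} h = trans (ℤP.pos-+ (h Fin.zero) _) (cong (λ x → + h Fin.zero + x) (pos-sum-tabulate (h ∘ Fin.suc)))

-- The characteristic is written k + 2: then Fin p visibly contains 0 and 1, and p − 1 is nonzero.
module PrimeField (L : FiniteField) (k : ℕ)
                  (p-prime : Prime (suc (suc k))) (char : HasCharacteristic L (suc (suc k))) where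

  p : ℕ
  p = suc (suc k)

  open FiniteField L
  import Data.Vec as Vec
  open Vec using (Vec; []; _∷_)
  open import Data.Vec.Functional using (init; last)
  open import Relation.Binary using (tri<; tri≈; tri>)
  open FieldProperties L
  open MonicPolynomials L
  open import Relation.Binary.Reasoning.Setoid setoid
  open import Algebra.Properties.Ring ring using (-‿distribʳ-*)
  open import Algebra.Properties.Semiring.Mult semiring using (×-homo-+; ×-assocˡ; ×-assoc-*; ×-homo-1; ×-congʳ)
  import Algebra.Properties.CommutativeSemiring.Binomial commutativeSemiring as Binomial
  open import Algebra.Properties.Monoid.Sum +-monoid using (sum; sum-init-last; sum-cong-≋; sum-replicate-zero)
  open import Data.Nat.Combinatorics using (_C_; nCn≡1)
  import Data.Nat.Divisibility as ℕ∣
  open import Data.Nat.Coprimality using (prime⇒coprime; coprime-Bézout)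
  open import Data.Nat.GCD using (module Bézout)
  import Algebra.Properties.Group +-group as +-Group

  ×-zeroʳ : ∀ m → m ×ᴸ 0# ≈ 0#
  ×-zeroʳ zero    = refl
  ×-zeroʳ (suc m) = trans (+-identityˡ _) (×-zeroʳ m)

  p×≈0 : ∀ x → p ×ᴸ x ≈ 0#
  p×≈0 x = begin
    p ×ᴸ x          ≈⟨ ×-congʳ p (*-identityˡ x) ⟨
    p ×ᴸ (1# * x)   ≈⟨ ×-assoc-* p 1# x ⟨
    (p ×ᴸ 1#) * x   ≈⟨ *-congʳ char ⟩
    0# * x          ≈⟨ zeroˡ x ⟩
    0#              ∎

  multiple-of-p×≈0 : ∀ {m} → p ℕ∣.∣ m → ∀ x → m ×ᴸ x ≈ 0#
  multiple-of-p×≈0 (ℕ∣.divides c ≡.refl) x = begin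
    (c ℕ.* p) ×ᴸ x   ≈⟨ ×-assocˡ x c p ⟨
    c ×ᴸ (p ×ᴸ x)    ≈⟨ ×-congʳ c (p×≈0 x) ⟩
    c ×ᴸ 0#          ≈⟨ ×-zeroʳ c ⟩
    0#               ∎

  frobenius-+ : ∀ x y → (x + y) ^ p ≈ x ^ p + y ^ p
  frobenius-+ x y = begin
    (x + y) ^ p                                        ≈⟨ Binomial.theorem p x y ⟩
    term Fin.zero + sum (term ∘ Fin.suc)               ≈⟨ +-cong first (sum-init-last (term ∘ Fin.suc)) ⟩
    y ^ p + (sum (init (term ∘ Fin.suc)) + last (term ∘ Fin.suc))
                                                       ≈⟨ +-congˡ (+-cong middle≈0 final) ⟩
    y ^ p + (0# + x ^ p)                               ≈⟨ +-congˡ (+-identityˡ _) ⟩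
    y ^ p + x ^ p                                      ≈⟨ +-comm _ _ ⟩
    x ^ p + y ^ p                                      ∎
    where
    term : Fin (suc p) → Carrier
    term = Binomial.binomialTerm x y p
    first : term Fin.zero ≈ y ^ p
    first = trans (×-homo-1 _) (*-identityˡ _)
    middle≈0 : sum (init (term ∘ Fin.suc)) ≈ 0#
    middle≈0 = trans (sum-cong-≋ (λ i → multiple-of-p×≈0 (p∣C i) (Binomial.binomial x y p (Fin.suc (Fin.inject₁ i)))))
                     (sum-replicate-zero (suc k))
      where
      p∣C : ∀ i → p ℕ∣.∣ p C suc (toℕ (Fin.inject₁ i))
      p∣C i = PrimeDivisibility.prime∣binomial p-prime (ℕ.s≤s ℕ.z≤n)
                (ℕ.s≤s (≡.subst (ℕ._< suc k) (≡.sym (FinP.toℕ-inject₁ i)) (FinP.toℕ<n i)))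
    final : last (term ∘ Fin.suc) ≈ x ^ p
    final = begin
      (p C suc (toℕ (Fin.fromℕ (suc k)))) ×ᴸ (x ^ suc (toℕ (Fin.fromℕ (suc k))) * y ^ (suc k ℕ.∸ toℕ (Fin.fromℕ (suc k))))
        ≡⟨ ≡.cong (λ m → (p C suc m) ×ᴸ (x ^ suc m * y ^ (suc k ℕ.∸ m))) (FinP.toℕ-fromℕ (suc k)) ⟩
      (p C p) ×ᴸ (x ^ p * y ^ (suc k ℕ.∸ suc k))
        ≡⟨ ≡.cong₂ (λ c e → c ×ᴸ (x ^ p * y ^ e)) (nCn≡1 p) (ℕP.n∸n≡0 (suc k)) ⟩
      1 ×ᴸ (x ^ p * 1#)  ≈⟨ ×-homo-1 _ ⟩
      x ^ p * 1#         ≈⟨ *-identityʳ _ ⟩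
      x ^ p              ∎

  frobenius-sum : ∀ xs → Σᴸ L xs ^ p ≈ Σᴸ L (List.map (_^ p) xs)
  frobenius-sum []       = zeroˡ _
  frobenius-sum (x ∷ xs) = trans (frobenius-+ x (Σᴸ L xs)) (+-congˡ (frobenius-sum xs))

  frobenius-×1 : ∀ m → (m ×ᴸ 1#) ^ p ≈ m ×ᴸ 1#
  frobenius-×1 zero    = zeroˡ _
  frobenius-×1 (suc m) = trans (frobenius-+ 1# (m ×ᴸ 1#)) (+-cong (1^ p) (frobenius-×1 m))

  multiple-×1≈0 : ∀ c {d} → d ×ᴸ 1# ≈ 0# → (c ℕ.* d) ×ᴸ 1# ≈ 0#
  multiple-×1≈0 c {d} d×1≈0 = trans (sym (×-assocˡ 1# c d)) (trans (×-congʳ c d×1≈0) (×-zeroʳ c))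

  ×1≉0 : ∀ {m} → 0 ℕ.< m → m ℕ.< p → ¬ m ×ᴸ 1# ≈ 0#
  ×1≉0 {m@(suc _)} _ m<p m×1≈0 with coprime-Bézout (prime⇒coprime p-prime m<p)
  ... | Bézout.+- a b eq = 1≉0 (begin
    1#                          ≈⟨ +-identityʳ 1# ⟨
    1# + 0#                     ≈⟨ +-congˡ (multiple-×1≈0 b m×1≈0) ⟨
    (1 ℕ.+ b ℕ.* m) ×ᴸ 1#       ≡⟨ ≡.cong (_×ᴸ 1#) eq ⟩
    (a ℕ.* p) ×ᴸ 1#             ≈⟨ multiple-×1≈0 a char ⟩
    0#                          ∎)
  ... | Bézout.-+ a b eq = 1≉0 (begin
    1#                          ≈⟨ +-identityʳ 1# ⟨
    1# + 0#                     ≈⟨ +-congˡ (multiple-×1≈0 a char) ⟨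
    (1 ℕ.+ a ℕ.* p) ×ᴸ 1#       ≡⟨ ≡.cong (_×ᴸ 1#) eq ⟩
    (b ℕ.* m) ×ᴸ 1#             ≈⟨ multiple-×1≈0 b m×1≈0 ⟩
    0#                          ∎)

  ×1-distinct : ∀ {m n} → m ℕ.< n → n ℕ.< p → ¬ m ×ᴸ 1# ≈ n ×ᴸ 1#
  ×1-distinct {m} {n} m<n n<p m≈n =
    ×1≉0 (ℕP.m<n⇒0<n∸m m<n) (ℕP.≤-<-trans (ℕP.m∸n≤m n m) n<p) (+-Group.∙-cancelˡ (m ×ᴸ 1#) _ _ (begin
      m ×ᴸ 1# + (n ℕ.∸ m) ×ᴸ 1#   ≈⟨ ×-homo-+ 1# m (n ℕ.∸ m) ⟨
      (m ℕ.+ (n ℕ.∸ m)) ×ᴸ 1#     ≡⟨ ≡.cong (_×ᴸ 1#) (ℕP.m+[n∸m]≡n (ℕP.<⇒≤ m<n)) ⟩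
      n ×ᴸ 1#                     ≈⟨ m≈n ⟨
      m ×ᴸ 1#                     ≈⟨ +-identityʳ _ ⟨
      m ×ᴸ 1# + 0#                ∎))

  embed : Fin p → Carrier
  embed t = toℕ t ×ᴸ 1#

  embed-injective : Injective _≡_ _≈_ embed
  embed-injective {s} {t} s≈t with ℕP.<-cmp (toℕ s) (toℕ t)
  ... | tri≈ _ s≡t _ = FinP.toℕ-injective s≡t
  ... | tri< s<t _ _ = contradiction s≈t (×1-distinct s<t (FinP.toℕ<n t))
  ... | tri> _ _ t<s = contradiction (sym s≈t) (×1-distinct t<s (FinP.toℕ<n s))

  InPrimeField : Carrier → Set
  InPrimeField z = ∃ λ t → z ≈ embed t

  -- If z ∉ 𝔽ₚ, then z and the p elements of 𝔽ₚ would be p + 1 distinct roots of x ^ p - x.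
  frobenius-fixed⇒InPrimeField : ∀ {z} → z ^ p ≈ z → InPrimeField z
  frobenius-fixed⇒InPrimeField {z} z^p≈z with FinP.any? (λ t → z ≟ embed t)
  ... | yes z∈𝔽ₚ = z∈𝔽ₚ
  ... | no  z∉𝔽ₚ = ⊥-elim (monic-root-bound x^p-x ρ ρ-injective roots)
    where
    x^p-x : Vec Carrier p
    x^p-x = 0# ∷ - 1# ∷ Vec.replicate k 0#
    evalMonic-xᵏ : ∀ m x → evalMonic (Vec.replicate m 0#) x ≈ x ^ m
    evalMonic-xᵏ zero    x = refl
    evalMonic-xᵏ (suc m) x = trans (+-identityˡ _) (*-congˡ (evalMonic-xᵏ m x))
    frobenius-fixed-root : ∀ x → x ^ p ≈ x → evalMonic x^p-x x ≈ 0#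
    frobenius-fixed-root x x^p≈x = begin
      0# + x * (- 1# + x * evalMonic (Vec.replicate k 0#) x)  ≈⟨ +-identityˡ _ ⟩
      x * (- 1# + x * evalMonic (Vec.replicate k 0#) x)       ≈⟨ *-congˡ (+-congˡ (*-congˡ (evalMonic-xᵏ k x))) ⟩
      x * (- 1# + x ^ suc k)                                  ≈⟨ distribˡ _ _ _ ⟩
      x * - 1# + x ^ p                                        ≈⟨ +-cong (trans (sym (-‿distribʳ-* x 1#)) (-‿cong (*-identityʳ x))) x^p≈x ⟩
      - x + x                                                 ≈⟨ -‿inverseˡ x ⟩
      0#                                                      ∎
    ρ : Fin (suc p) → Carrier
    ρ Fin.zero    = z
    ρ (Fin.suc t) = embed t
    ρ-injective : Injective _≡_ _≈_ ρ
    ρ-injective {Fin.zero}  {Fin.zero}  _   = ≡.refl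
    ρ-injective {Fin.zero}  {Fin.suc t} z≈t = contradiction (t , z≈t) z∉𝔽ₚ
    ρ-injective {Fin.suc s} {Fin.zero}  s≈z = contradiction (s , sym s≈z) z∉𝔽ₚ
    ρ-injective {Fin.suc s} {Fin.suc t} s≈t = ≡.cong Fin.suc (embed-injective s≈t)
    roots : ∀ i → evalMonic x^p-x (ρ i) ≈ 0#
    roots Fin.zero    = frobenius-fixed-root z z^p≈z
    roots (Fin.suc t) = frobenius-fixed-root (embed t) (frobenius-×1 (toℕ t))

module Trace (L : FiniteField) (k : ℕ)
             (p-prime : Prime (suc (suc k))) (char : HasCharacteristic L (suc (suc k)))
             (n : ℕ) (order≡pⁿ : FiniteField.order L ≡ suc (suc k) ℕ.^ n) where

  open FiniteField L
  open FieldProperties L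
  open Fermat L using (fermat)
  open PrimeField L k p-prime char
  open import Relation.Binary.Reasoning.Setoid setoid
  open import Algebra.Properties.Semiring.Exp semiring using (^-congˡ; ^-assocʳ)
  open import Algebra.Properties.CommutativeSemiring.Exp commutativeSemiring using (^-distrib-*)
  import Algebra.Properties.Group +-group as +-Group

  Tr : Carrier → Carrier
  Tr = trace L p n

  frobenius-+-iterated : ∀ i x y → (x + y) ^ (p ℕ.^ i) ≈ x ^ (p ℕ.^ i) + y ^ (p ℕ.^ i)
  frobenius-+-iterated zero    x y = trans (*-identityʳ _) (sym (+-cong (*-identityʳ x) (*-identityʳ y)))
  frobenius-+-iterated (suc i) x y = begin
    (x + y) ^ (p ℕ.* p ℕ.^ i)                   ≈⟨ ^-assocʳ _ p (p ℕ.^ i) ⟨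
    ((x + y) ^ p) ^ (p ℕ.^ i)                   ≈⟨ ^-congˡ (p ℕ.^ i) (frobenius-+ x y) ⟩
    (x ^ p + y ^ p) ^ (p ℕ.^ i)                 ≈⟨ frobenius-+-iterated i (x ^ p) (y ^ p) ⟩
    (x ^ p) ^ (p ℕ.^ i) + (y ^ p) ^ (p ℕ.^ i)   ≈⟨ +-cong (^-assocʳ x p (p ℕ.^ i)) (^-assocʳ y p (p ℕ.^ i)) ⟩
    x ^ (p ℕ.* p ℕ.^ i) + y ^ (p ℕ.* p ℕ.^ i)   ∎

  frobenius-fixed-iterated : ∀ {c} → c ^ p ≈ c → ∀ i → c ^ (p ℕ.^ i) ≈ c
  frobenius-fixed-iterated {c} c^p≈c zero    = *-identityʳ c
  frobenius-fixed-iterated {c} c^p≈c (suc i) =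
    trans (sym (^-assocʳ c p (p ℕ.^ i))) (trans (^-congˡ (p ℕ.^ i) c^p≈c) (frobenius-fixed-iterated c^p≈c i))

  trace-cong : ∀ {x y} → x ≈ y → Tr x ≈ Tr y
  trace-cong x≈y = Σᴸ-map-cong (List.upTo n) (λ i → ^-congˡ (p ℕ.^ i) x≈y)

  trace-+ : ∀ x y → Tr (x + y) ≈ Tr x + Tr y
  trace-+ x y = trans (Σᴸ-map-cong (List.upTo n) (λ i → frobenius-+-iterated i x y))
                      (Σᴸ-map-+ (λ i → x ^ (p ℕ.^ i)) (λ i → y ^ (p ℕ.^ i)) (List.upTo n))

  trace-scalar : ∀ {c} → c ^ p ≈ c → ∀ x → Tr (c * x) ≈ c * Tr x
  trace-scalar {c} c^p≈c x =
    trans (Σᴸ-map-cong (List.upTo n) (λ i → trans (^-distrib-* c x (p ℕ.^ i)) (*-congʳ (frobenius-fixed-iterated c^p≈c i))))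
          (Σᴸ-map-*ˡ c (λ i → x ^ (p ℕ.^ i)) (List.upTo n))

  trace-0 : Tr 0# ≈ 0#
  trace-0 = begin
    Tr 0#         ≈⟨ trace-cong (zeroˡ 0#) ⟨
    Tr (0# * 0#)  ≈⟨ trace-scalar (zeroˡ _) 0# ⟩
    0# * Tr 0#    ≈⟨ zeroˡ _ ⟩
    0#            ∎

  trace-neg : ∀ x → Tr (- x) ≈ - Tr x
  trace-neg x = +-Group.inverseʳ-unique (Tr x) (Tr (- x))
    (trans (sym (trace-+ x (- x))) (trans (trace-cong (-‿inverseʳ x)) trace-0))

  trace-sub : ∀ x y → Tr (x - y) ≈ Tr x - Tr y
  trace-sub x y = trans (trace-+ x (- y)) (+-congˡ (trace-neg y))

  trace-frobenius-fixed : ∀ x → Tr x ^ p ≈ Tr x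
  trace-frobenius-fixed x = begin
    Tr x ^ p                                        ≈⟨ frobenius-sum (List.map g (List.upTo n)) ⟩
    Σᴸ L (List.map (_^ p) (List.map g (List.upTo n)))  ≡⟨ ≡.cong (Σᴸ L) (ListP.map-∘ (List.upTo n)) ⟨
    Σᴸ L (List.map (λ i → g i ^ p) (List.upTo n))   ≈⟨ Σᴸ-map-cong (List.upTo n) g[i]^p≈g[1+i] ⟩
    Σᴸ L (List.map (g ∘ suc) (List.upTo n))         ≡⟨ ≡.cong (Σᴸ L) (ListP.map-applyUpTo (λ i → i) (g ∘ suc) n) ⟩
    Σᴸ L (List.applyUpTo (g ∘ suc) n)               ≈⟨ Σᴸ-rotate g n gₙ≈g₀ ⟩
    Σᴸ L (List.applyUpTo g n)                       ≡⟨ ≡.cong (Σᴸ L) (ListP.map-applyUpTo (λ i → i) g n) ⟨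
    Tr x                                            ∎
    where
    g : ℕ → Carrier
    g i = x ^ (p ℕ.^ i)
    g[i]^p≈g[1+i] : ∀ i → g i ^ p ≈ g (suc i)
    g[i]^p≈g[1+i] i = trans (^-assocʳ x (p ℕ.^ i) p) (reflexive (≡.cong (x ^_) (ℕP.*-comm (p ℕ.^ i) p)))
    gₙ≈g₀ : g n ≈ g 0
    gₙ≈g₀ = trans (≡.subst (λ e → x ^ e ≈ x) order≡pⁿ (fermat x)) (sym (*-identityʳ x))

  trace∈𝔽ₚ : ∀ x → InPrimeField (Tr x)
  trace∈𝔽ₚ x = frobenius-fixed⇒InPrimeField (trace-frobenius-fixed x)


module WeilSums (L : FiniteField) (k : ℕ)
                (p-prime : Prime (suc (suc k))) (char : HasCharacteristic L (suc (suc k)))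
                (n : ℕ) (order≡pⁿ : FiniteField.order L ≡ suc (suc k) ℕ.^ n)
                (s : ℕ) (s≥1 : 1 ℕ.≤ s) (gcd≡1 : gcd s (FiniteField.order L ℕ.∸ 1) ≡ 1) where

  open FiniteField L
  open FieldProperties L
  open Fermat L using (^-permutation)
  open Counting L
  open PrimeField L k p-prime char
  open Trace L k p-prime char n order≡pⁿ
  open import Data.Integer as ℤ using (ℤ; +_)
  import Data.Integer.Properties as ℤP
  open IntegerSums
    using (sum; sum-cong-≋; ∑-comm; sum-const; sum-constant-off; sum-*-sum; sum-affine;
           three-valued-sums; integer-class-moments; moment-from-count)
  import Algebra.Properties.Group +-group as +-Group
  open import Algebra.Properties.Semiring.Exp semiring using (^-congˡ)
  open import Algebra.Properties.Ring ring using (x[y-z]≈xy-xz)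
  open import Function.Bundles using (_⇔_; mk⇔)
  open ≡.≡-Reasoning

  q : ℕ
  q = order

  W : Carrier → Cyc p
  W = weil L p n s

  term : Carrier → Carrier → Carrier
  term a x = x ^ s - a * x

  W≡∑ : ∀ a t → W a t ≡ ∑ (λ x → 𝟙 (Tr (term a x) ≟ embed t))
  W≡∑ a t = countL≡∑ (λ x → Tr (term a x) ≈ embed t) (λ x → Tr (term a x) ≟ embed t)

  𝟙-cong : ∀ {x x′ z z′} → x ≈ x′ → z ≈ z′ → 𝟙 (x ≟ z) ≡ 𝟙 (x′ ≟ z′)
  𝟙-cong {x} {x′} {z} {z′} x≈x′ z≈z′ = 𝟙-⇔ (x ≟ z) (x′ ≟ z′) (mk⇔
    (λ x≈z → trans (sym x≈x′) (trans x≈z z≈z′))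
    (λ x′≈z′ → trans x≈x′ (trans x′≈z′ (sym z≈z′))))

  𝟙-embed-off : ∀ {z t₀ t} → z ≈ embed t₀ → t ≢ t₀ → 𝟙 (z ≟ embed t) ≡ + 0
  𝟙-embed-off {z} {t = t} z≈t₀ t≢t₀ = 𝟙-no (z ≟ embed t) (λ z≈t → t≢t₀ (embed-injective (trans (sym z≈t) z≈t₀)))

  ∑-𝟙-embed : ∀ {z} → InPrimeField z → sum (λ t → 𝟙 (z ≟ embed t)) ≡ + 1
  ∑-𝟙-embed {z} (t₀ , z≈t₀) = ≡.trans (sum-supported-at ℤP.+-0-commutativeMonoid _ t₀ (λ t → 𝟙-embed-off z≈t₀))
                                       (𝟙-yes (z ≟ embed t₀) z≈t₀)

  ∑-𝟙-embed-pair : ∀ {z} w → InPrimeField z →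
    sum (λ t → 𝟙 (z ≟ embed t) ℤ.* 𝟙 (w ≟ embed t)) ≡ 𝟙 (z ≟ w)
  ∑-𝟙-embed-pair {z} w (t₀ , z≈t₀) = begin
    sum (λ t → 𝟙 (z ≟ embed t) ℤ.* 𝟙 (w ≟ embed t))
      ≡⟨ sum-supported-at ℤP.+-0-commutativeMonoid _ t₀ (λ t t≢t₀ → ≡.cong (ℤ._* 𝟙 (w ≟ embed t)) (𝟙-embed-off z≈t₀ t≢t₀)) ⟩
    𝟙 (z ≟ embed t₀) ℤ.* 𝟙 (w ≟ embed t₀)
      ≡⟨ ≡.cong (ℤ._* 𝟙 (w ≟ embed t₀)) (𝟙-yes (z ≟ embed t₀) z≈t₀) ⟩
    + 1 ℤ.* 𝟙 (w ≟ embed t₀)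
      ≡⟨ ℤP.*-identityˡ _ ⟩
    𝟙 (w ≟ embed t₀)
      ≡⟨ 𝟙-⇔ (w ≟ embed t₀) (z ≟ w) (mk⇔ (λ w≈t₀ → trans z≈t₀ (sym w≈t₀)) (λ z≈w → trans (sym z≈w) z≈t₀)) ⟩
    𝟙 (z ≟ w) ∎

  W-total : ∀ a → sum (W a) ≡ + q
  W-total a = begin
    sum (W a)                                              ≡⟨ sum-cong-≋ (W≡∑ a) ⟩
    sum (λ t → ∑ (λ x → 𝟙 (Tr (term a x) ≟ embed t)))      ≡⟨ ∑-comm (λ t i → 𝟙 (Tr (term a (enum i)) ≟ embed t)) ⟩
    ∑ (λ x → sum (λ t → 𝟙 (Tr (term a x) ≟ embed t)))      ≡⟨ sum-cong-≋ (λ i → ∑-𝟙-embed (trace∈𝔽ₚ (term a (enum i)))) ⟩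
    ∑ (λ _ → + 1)                                          ≡⟨ ∑-1 ⟩
    + q                                                    ∎

  -- If Tr ≡ 0 then W a = (q, 0, …, 0), which represents the integer q ≠ 0.
  trace-nontrivial : ∀ {a} → W a ≈ᶜ ι (+ 0) → ∃ λ y → ¬ Tr y ≈ 0#
  trace-nontrivial {a} (c , W≡ι0+c) with FinP.¬∀⟶∃¬ q _ (λ i → Tr (enum i) ≟ 0#) not-all-zero
    where
    not-all-zero : ¬ (∀ i → Tr (enum i) ≈ 0#)
    not-all-zero all-zero = order≢0 (ℤP.+-injective (begin
      + q                      ≡⟨ ∑-𝟙-all (λ x → Tr (term a x) ≟ 0#) (λ x → Tr≈0 (term a x)) ⟨
      ∑ (λ x → 𝟙 (Tr (term a x) ≟ 0#))
                               ≡⟨ W≡∑ a Fin.zero ⟨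
      W a Fin.zero             ≡⟨ ≡.trans (W≡ι0+c Fin.zero) (≡.sym (W≡ι0+c (Fin.suc Fin.zero))) ⟩
      W a (Fin.suc Fin.zero)   ≡⟨ W≡∑ a (Fin.suc Fin.zero) ⟩
      ∑ (λ x → 𝟙 (Tr (term a x) ≟ embed (Fin.suc Fin.zero)))
                               ≡⟨ ∑-𝟙-none (λ x → Tr (term a x) ≟ embed (Fin.suc Fin.zero)) (λ x Tr≈1 →
                                    1≉0 (trans (sym (+-identityʳ 1#)) (trans (sym Tr≈1) (Tr≈0 (term a x))))) ⟩
      + 0                      ∎))
      where
      Tr≈0 : ∀ x → Tr x ≈ 0#
      Tr≈0 x = trans (trace-cong (sym (enum-index x))) (all-zero (index x))
  ... | i , Tr≉0 = enum i , Tr≉0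

  #Tr : Carrier → ℤ
  #Tr z = ∑ (λ y → 𝟙 (Tr y ≟ z))

  #Tr-cong : ∀ {z z′} → z ≈ z′ → #Tr z ≡ #Tr z′
  #Tr-cong z≈z′ = sum-cong-≋ (λ i → 𝟙-cong {Tr (enum i)} refl z≈z′)

  #Tr-permute : ∀ (π : Inverse setoid setoid) z → ∑ (λ y → 𝟙 (Tr (Inverse.to π y) ≟ z)) ≡ #Tr z
  #Tr-permute π z = ≡.sym (∑ᴸ-permute ℤP.+-0-commutativeMonoid π (λ y → 𝟙 (Tr y ≟ z))
                                       (λ x≈y → 𝟙-cong (trace-cong x≈y) refl))

  #Tr-translate : ∀ z w → #Tr (z + Tr w) ≡ #Tr z
  #Tr-translate z w = ≡.trans (≡.sym (#Tr-permute (+-permutation w) (z + Tr w)))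
    (sum-cong-≋ λ i → 𝟙-⇔ (Tr (enum i + w) ≟ (z + Tr w)) (Tr (enum i) ≟ z) (mk⇔
      (λ Tr[y+w]≈z+Tr[w] → +-Group.∙-cancelʳ (Tr w) _ _ (trans (sym (trace-+ _ w)) Tr[y+w]≈z+Tr[w]))
      (λ Tr[y]≈z → trans (trace-+ _ w) (+-congʳ Tr[y]≈z))))

  module Balanced (y₀ : Carrier) (Tr[y₀]≉0 : ¬ Tr y₀ ≈ 0#) where

    y₁ : Carrier
    y₁ = Tr y₀ ⁻¹[ Tr[y₀]≉0 ] * y₀

    Tr[y₁]≈1 : Tr y₁ ≈ 1#
    Tr[y₁]≈1 = trans (trace-scalar (^-fixed-⁻¹ Tr[y₀]≉0 p (trace-frobenius-fixed y₀)) y₀)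
                     (*-inverseˡ (Tr y₀) Tr[y₀]≉0)

    m : ℤ
    m = #Tr 0#

    -- Translation by t·y₁ maps the fibre of Tr over 0 onto the fibre over t.
    #Tr-𝔽ₚ : ∀ {z} → InPrimeField z → #Tr z ≡ m
    #Tr-𝔽ₚ {z} (t , z≈t) = ≡.trans (#Tr-cong z≈0+Tr[ty₁]) (#Tr-translate 0# (embed t * y₁))
      where
      z≈0+Tr[ty₁] : z ≈ 0# + Tr (embed t * y₁)
      z≈0+Tr[ty₁] = sym (trans (+-identityˡ _) (trans (trace-scalar (frobenius-×1 (toℕ t)) y₁)
                                                 (trans (*-congˡ Tr[y₁]≈1) (trans (*-identityʳ _) (sym z≈t)))))

    p*m≡q : + p ℤ.* m ≡ + q
    p*m≡q = begin
      + p ℤ.* m                                  ≡⟨ sum-const p m ⟨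
      sum {p} (λ _ → m)                          ≡⟨ sum-cong-≋ (λ t → #Tr-𝔽ₚ (t , refl)) ⟨
      sum (λ t → #Tr (embed t))                  ≡⟨ ∑-comm (λ t i → 𝟙 (Tr (enum i) ≟ embed t)) ⟩
      ∑ (λ y → sum (λ t → 𝟙 (Tr y ≟ embed t)))   ≡⟨ sum-cong-≋ (λ i → ∑-𝟙-embed (trace∈𝔽ₚ (enum i))) ⟩
      ∑ (λ _ → + 1)                              ≡⟨ ∑-1 ⟩
      + q                                        ∎

    #Tr-scaled : ∀ {d z} → ¬ d ≈ 0# → InPrimeField z → ∑ (λ a → 𝟙 (Tr (d * a) ≟ z)) ≡ m
    #Tr-scaled {z = z} d≉0 z∈𝔽ₚ = ≡.trans (#Tr-permute (*-permutation d≉0) z) (#Tr-𝔽ₚ z∈𝔽ₚ)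

    weil-at-0 : ∀ {a} → a ≈ 0# → W a ≈ᶜ ι (+ 0)
    weil-at-0 {a} a≈0 = m , λ t → begin
      W a t                                    ≡⟨ W≡∑ a t ⟩
      ∑ (λ x → 𝟙 (Tr (term a x) ≟ embed t))    ≡⟨ sum-cong-≋ (λ i → 𝟙-cong (trace-cong (term≈x^s (enum i))) refl) ⟩
      ∑ (λ x → 𝟙 (Tr (x ^ s) ≟ embed t))       ≡⟨ #Tr-permute (^-permutation s≥1 gcd≡1) (embed t) ⟩
      #Tr (embed t)                            ≡⟨ #Tr-𝔽ₚ (t , refl) ⟩
      m                                        ≡⟨ ι0+m t ⟨
      ι (+ 0) t ℤ.+ m                          ∎
      where
      term≈x^s : ∀ x → term a x ≈ x ^ s
      term≈x^s x = trans (+-congˡ (trans (-‿cong (trans (*-congʳ a≈0) (zeroˡ x))) +-Group.ε⁻¹≈ε)) (+-identityʳ _)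
      ι0+m : ∀ t → ι (+ 0) t ℤ.+ m ≡ m
      ι0+m Fin.zero    = ℤP.+-identityˡ m
      ι0+m (Fin.suc _) = ℤP.+-identityˡ m

    coincidences : Carrier → Carrier → ℤ
    coincidences x y = ∑ (λ a → 𝟙 (Tr (term a x) ≟ Tr (term a y)))

    coincidences-≈ : ∀ {x y} → x ≈ y → coincidences x y ≡ + q
    coincidences-≈ {x} {y} x≈y = ∑-𝟙-all (λ a → Tr (term a x) ≟ Tr (term a y))
      (λ a → trace-cong (+-cong (^-congˡ s x≈y) (-‿cong (*-congˡ x≈y))))

    coincidence⇔ : ∀ a x y → (Tr (term a x) ≈ Tr (term a y)) ⇔ (Tr ((y - x) * a) ≈ Tr (y ^ s - x ^ s))
    coincidence⇔ a x y = mk⇔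
      (λ eq → trans Tr-[y-x]a (trans (swap-differences +-abelianGroup (trans (sym (trace-sub _ _)) (trans eq (trace-sub _ _))))
                                      (sym (trace-sub _ _))))
      (λ eq → trans (trace-sub _ _) (trans (swap-differences +-abelianGroup (trans (sym Tr-[y-x]a) (trans eq (trace-sub _ _))))
                                          (sym (trace-sub _ _))))
      where
      Tr-[y-x]a : Tr ((y - x) * a) ≈ Tr (a * y) - Tr (a * x)
      Tr-[y-x]a = trans (trace-cong (trans (*-comm _ a) (x[y-z]≈xy-xz a y x))) (trace-sub _ _)

    coincidences-≉ : ∀ {x y} → ¬ x ≈ y → coincidences x y ≡ m
    coincidences-≉ {x} {y} x≉y = ≡.trans
      (sum-cong-≋ (λ i → 𝟙-⇔ (Tr (term (enum i) x) ≟ Tr (term (enum i) y))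
                             (Tr ((y - x) * enum i) ≟ Tr (y ^ s - x ^ s))
                             (coincidence⇔ (enum i) x y)))
      (#Tr-scaled (λ y-x≈0 → x≉y (sym (+-Group.x∙y⁻¹≈ε⇒x≈y y x y-x≈0))) (trace∈𝔽ₚ _))

    ∑-coincidences : ∀ y → ∑ (λ x → coincidences x y) ≡ + q ℤ.* m ℤ.+ (+ q ℤ.- m)
    ∑-coincidences y = ≡.trans
      (sum-constant-off (λ i → coincidences (enum i) y) (index y) m
        (λ i i≢y → coincidences-≉ (λ eᵢ≈y → i≢y (enum-injective (trans eᵢ≈y (sym (enum-index y)))))))
      (≡.cong (λ c → + q ℤ.* m ℤ.+ (c ℤ.- m)) (coincidences-≈ (enum-index y)))

    first-moment-count : ∑ (λ a → W a Fin.zero) ≡ ∑ (λ x → coincidences x 0#)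
    first-moment-count = begin
      ∑ (λ a → W a Fin.zero)                          ≡⟨ sum-cong-≋ (λ i → W≡∑ (enum i) Fin.zero) ⟩
      ∑ (λ a → ∑ (λ x → 𝟙 (Tr (term a x) ≟ 0#)))      ≡⟨ ∑-comm (λ i j → 𝟙 (Tr (term (enum i) (enum j)) ≟ 0#)) ⟩
      ∑ (λ x → ∑ (λ a → 𝟙 (Tr (term a x) ≟ 0#)))
        ≡⟨ sum-cong-≋ (λ j → sum-cong-≋ (λ i → 𝟙-cong {Tr (term (enum i) (enum j))} refl (sym (Tr[term-0]≈0 (enum i))))) ⟩
      ∑ (λ x → coincidences x 0#)                     ∎
      where
      Tr[term-0]≈0 : ∀ a → Tr (term a 0#) ≈ 0#
      Tr[term-0]≈0 a = trans (trace-cong (trans (+-cong (0^-nonzero (ℕP.n>0⇒n≢0 s≥1)) (-‿cong (zeroʳ a))) (-‿inverseʳ 0#)))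
                             trace-0

    second-moment-count : ∑ (λ a → sum (λ t → W a t ℤ.* W a t)) ≡ ∑ (λ x → ∑ (λ y → coincidences x y))
    second-moment-count = begin
      ∑ (λ a → sum (λ t → W a t ℤ.* W a t))                        ≡⟨ sum-cong-≋ (λ i → squares (enum i)) ⟩
      ∑ (λ a → ∑ (λ x → ∑ (λ y → 𝟙 (Tr (term a x) ≟ Tr (term a y)))))
        ≡⟨ ∑-comm (λ i j → ∑ (λ y → 𝟙 (Tr (term (enum i) (enum j)) ≟ Tr (term (enum i) y)))) ⟩
      ∑ (λ x → ∑ (λ a → ∑ (λ y → 𝟙 (Tr (term a x) ≟ Tr (term a y)))))
        ≡⟨ sum-cong-≋ (λ j → ∑-comm (λ i l → 𝟙 (Tr (term (enum i) (enum j)) ≟ Tr (term (enum i) (enum l))))) ⟩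
      ∑ (λ x → ∑ (λ y → coincidences x y))                                    ∎
      where
      squares : ∀ a → sum (λ t → W a t ℤ.* W a t) ≡ ∑ (λ x → ∑ (λ y → 𝟙 (Tr (term a x) ≟ Tr (term a y))))
      squares a = begin
        sum (λ t → W a t ℤ.* W a t)                               ≡⟨ sum-cong-≋ (λ t → ≡.cong₂ ℤ._*_ (W≡∑ a t) (W≡∑ a t)) ⟩
        sum (λ t → ∑ (λ x → I x t) ℤ.* ∑ (λ y → I y t))           ≡⟨ sum-cong-≋ (λ t → sum-*-sum (λ i → I (enum i) t) (λ j → I (enum j) t)) ⟩
        sum (λ t → ∑ (λ x → ∑ (λ y → I x t ℤ.* I y t)))           ≡⟨ ∑-comm (λ t i → ∑ (λ y → I (enum i) t ℤ.* I y t)) ⟩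
        ∑ (λ x → sum (λ t → ∑ (λ y → I x t ℤ.* I y t)))           ≡⟨ sum-cong-≋ (λ i → ∑-comm (λ t j → I (enum i) t ℤ.* I (enum j) t)) ⟩
        ∑ (λ x → ∑ (λ y → sum (λ t → I x t ℤ.* I y t)))
          ≡⟨ sum-cong-≋ (λ i → sum-cong-≋ (λ j → ∑-𝟙-embed-pair (Tr (term a (enum j))) (trace∈𝔽ₚ (term a (enum i))))) ⟩
        ∑ (λ x → ∑ (λ y → 𝟙 (Tr (term a x) ≟ Tr (term a y))))    ∎
        where
        I : Carrier → Fin p → ℤ
        I x t = 𝟙 (Tr (term a x) ≟ embed t)

    power-moments : (V : Carrier → ℤ) → (∀ a → W a ≈ᶜ ι (V a)) →
      ∑ V ≡ + q × ∑ (λ a → V a ℤ.* V a) ≡ + q ℤ.* + q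
    power-moments V W≈ιV =
      moment-from-count {+ suc k} (+ q) (+ 1) (≡.sym (ℤP.*-identityˡ (+ q))) p*m≡q
        (sum-affine (λ i → W (enum i) Fin.zero) (V ∘ enum) (+ p) (+ q) (+ suc k) (first ∘ enum))
        (≡.trans first-moment-count (≡.trans (∑-coincidences 0#) (≡.sym (ℤP.*-identityˡ _)))) ,
      moment-from-count {+ suc k} (+ q) (+ q) ≡.refl p*m≡q
        (sum-affine (λ i → sum (λ t → W (enum i) t ℤ.* W (enum i) t)) (λ i → V (enum i) ℤ.* V (enum i))
                    (+ p) (+ q ℤ.* + q) (+ suc k) (second ∘ enum))
        (begin
          ∑ (λ a → sum (λ t → W a t ℤ.* W a t))   ≡⟨ second-moment-count ⟩
          ∑ (λ x → ∑ (λ y → coincidences x y))     ≡⟨ ∑-comm (λ i j → coincidences (enum i) (enum j)) ⟩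
          ∑ (λ y → ∑ (λ x → coincidences x y))     ≡⟨ sum-cong-≋ (λ j → ∑-coincidences (enum j)) ⟩
          ∑ (λ _ → + q ℤ.* m ℤ.+ (+ q ℤ.- m))      ≡⟨ sum-const q _ ⟩
          + q ℤ.* (+ q ℤ.* m ℤ.+ (+ q ℤ.- m))      ∎)
      where
      first : ∀ a → + p ℤ.* W a Fin.zero ≡ + q ℤ.+ + suc k ℤ.* V a
      first a = ≡.trans (proj₁ (integer-class-moments (W a) (V a) (W≈ιV a)))
                        (≡.cong (ℤ._+ (+ suc k ℤ.* V a)) (W-total a))
      second : ∀ a → + p ℤ.* sum (λ t → W a t ℤ.* W a t) ≡ + q ℤ.* + q ℤ.+ + suc k ℤ.* (V a ℤ.* V a)
      second a = ≡.trans (proj₂ (integer-class-moments (W a) (V a) (W≈ιV a)))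
                         (≡.cong (λ x → x ℤ.* x ℤ.+ + suc k ℤ.* (V a ℤ.* V a)) (W-total a))

    three-valued-moments : ∀ {A B} → (∀ a → ¬ a ≈ 0# → W a ≈ᶜ ι (+ 0) ⊎ W a ≈ᶜ ι A ⊎ W a ≈ᶜ ι B) →
      ∃₂ λ nA nB → A ℤ.* nA ℤ.+ B ℤ.* nB ≡ + q × A ℤ.* A ℤ.* nA ℤ.+ B ℤ.* B ℤ.* nB ≡ + q ℤ.* + q
    three-valued-moments {A} {B} three-valued =
      combine (three-valued-sums (V ∘ enum) (λ i → proj₁ (proj₂ (value (enum i)))))
              (power-moments V (λ a → proj₂ (proj₂ (value a))))
      where
      value : ∀ a → ∃ λ V → (V ≡ + 0 ⊎ V ≡ A ⊎ V ≡ B) × W a ≈ᶜ ι V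
      value a with a ≟ 0#
      ... | yes a≈0 = + 0 , inj₁ ≡.refl , weil-at-0 a≈0
      ... | no  a≉0 with three-valued a a≉0
      ...   | inj₁ W≈ι0        = + 0 , inj₁ ≡.refl , W≈ι0
      ...   | inj₂ (inj₁ W≈ιA) = A , inj₂ (inj₁ ≡.refl) , W≈ιA
      ...   | inj₂ (inj₂ W≈ιB) = B , inj₂ (inj₂ ≡.refl) , W≈ιB
      V : Carrier → ℤ
      V a = proj₁ (value a)
      combine : ∀ {S₁ S₂} → (∃₂ λ nA nB → S₁ ≡ A ℤ.* nA ℤ.+ B ℤ.* nB × S₂ ≡ A ℤ.* A ℤ.* nA ℤ.+ B ℤ.* B ℤ.* nB) →
        S₁ ≡ + q × S₂ ≡ + q ℤ.* + q →
        ∃₂ λ nA nB → A ℤ.* nA ℤ.+ B ℤ.* nB ≡ + q × A ℤ.* A ℤ.* nA ℤ.+ B ℤ.* B ℤ.* nB ≡ + q ℤ.* + q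
      combine (nA , nB , S₁≡ , S₂≡) (S₁≡q , S₂≡q²) = nA , nB , ≡.trans (≡.sym S₁≡) S₁≡q , ≡.trans (≡.sym S₂≡) S₂≡q²


open import Data.Nat using (_≥_; _∸_)
open import Data.Integer using (ℤ; +_; _*_; _-_)
open import Data.Integer.Divisibility using (_∣_)
open import Data.Integer.Coprimality using (Coprime)

mainTheorem2 : (L : FiniteField) →
    (p n : ℕ) → Prime p → HasCharacteristic L p → FiniteField.order L ≡ p ℕ.^ n →
    (s : ℕ) → s ≥ 1 → gcd s (FiniteField.order L ∸ 1) ≡ 1 →
    (A B : ℤ) → A ≢ + 0 → B ≢ + 0 → A ≢ B →
    ((a : FiniteField.Carrier L) → Nonzero L a →
      (weil L p n s a ≈ᶜ ι (+ 0)) ⊎ (weil L p n s a ≈ᶜ ι A) ⊎ (weil L p n s a ≈ᶜ ι B)) →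
    (∃ λ a → Nonzero L a × (weil L p n s a ≈ᶜ ι (+ 0))) →
    (∃ λ a → Nonzero L a × (weil L p n s a ≈ᶜ ι A)) →
    (∃ λ a → Nonzero L a × (weil L p n s a ≈ᶜ ι B)) →
    (ea eb ec : ℕ) (α β γ : ℤ) →
    A ≡ + (p ℕ.^ ea) * α → B ≡ + (p ℕ.^ eb) * β → A - B ≡ + (p ℕ.^ ec) * γ →
    ¬ (+ p ∣ α) → ¬ (+ p ∣ β) → ¬ (+ p ∣ γ) →
    Coprime α β × Coprime α γ × Coprime β γ ×
    (α * γ ∣ + FiniteField.order L - B) × (β * γ ∣ + FiniteField.order L - A)
mainTheorem2 L 0 n ()
mainTheorem2 L 1 n ()
mainTheorem2 L (suc (suc k)) n p-prime char order≡pⁿ s s≥1 gcd≡1 A B _ _ _ three-valued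
             (_ , _ , W≈0) _ _ ea eb ec α β γ A≡ B≡ A-B≡ p∤α p∤β p∤γ =
  case three-valued-moments three-valued of λ where
    (nA , nB , first , second) →
      ≡.subst (λ q → Coprime α β × Coprime α γ × Coprime β γ × (α * γ ∣ + q - B) × (β * γ ∣ + q - A))
              (≡.sym order≡pⁿ)
              (PrimeDivisibility.divisibility-from-moments p-prime {n = n}
                (≡.trans first (≡.cong +_ order≡pⁿ)) (≡.trans second (≡.cong (λ q → + q * + q) order≡pⁿ))
                ea eb ec α β γ A≡ B≡ A-B≡ p∤α p∤β p∤γ)
  where
  open WeilSums L k p-prime char n order≡pⁿ s s≥1 gcd≡1
  open Balanced (proj₁ (trace-nontrivial W≈0)) (proj₂ (trace-nontrivial W≈0))
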